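{- Let $X$ be an $r$-uniform hypergraph. If $k$ is a positive integer such that $\Delta(X)\ge 3k(\log(2k)+(r-1)\log v(X))$, then there exists a partition $V_1,\dots,V_k$ of $V(X)$ such that $|V_i|\le 2\cdot\frac{v(X)}{k}$ for all $i\in[k]$ and, for every $(r-1)$-subset $S$ of $V(X)$ and every $i\in[k]$, the number of vertices $v\in V_i$ with $S\cup\{v\}\in E(X)$ is at most $2\cdot\frac{\Delta(X)}{k}$.
   Context: An $r$-uniform hypergraph $X$ has vertex set $V(X)$, $v(X)=|V(X)|$, and edge set of $r$-subsets. $\Delta(X)$ is the maximum, over $(r-1)$-subsets $S$ of $V(X)$, of the number of edges of $X$ containing $S$. $\log$ is the natural logarithm. A partition may have empty parts. -}

module Defs where

open import Data.Nat as ℕ using (ℕ; zero; suc; _⊔_; _∸_)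
open import Data.Bool using (Bool; true; false; T; _∧_)
open import Data.List using (List; []; _∷_; map; _++_; filterᵇ; length; foldr)
open import Data.Vec using (_∷_; [])
open import Data.Fin using (Fin; _≟_)
open import Data.Fin.Subset using (Subset; ∣_∣; _∪_; ⁅_⁆; inside; outside)
open import Data.Fin.Subset.Properties using (_⊆?_)
open import Data.Product using (∃-syntax)
open import Data.Integer using (+_)
open import Data.Rational using (ℚ; 0ℚ; 1ℚ; _+_; _*_; _-_; _/_; _≤_; _>_)
open import Relation.Nullary using (does)
open import Relation.Binary.PropositionalEquality using (_≡_)
import Data.List as L

record UniformHypergraph (r : ℕ) : Set where
  field
    n       : ℕ
    isEdge  : Subset n → Bool
    uniform : ∀ e → T (isEdge e) → ∣ e ∣ ≡ r
open UniformHypergraph public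

v : ∀ {r} → UniformHypergraph r → ℕ
v X = n X

allSubsets : (m : ℕ) → List (Subset m)
allSubsets zero    = [] ∷ []
allSubsets (suc m) = map (inside ∷_) (allSubsets m) ++ map (outside ∷_) (allSubsets m)

allVertices : (m : ℕ) → List (Fin m)
allVertices m = L.allFin m

degree : ∀ {r} (X : UniformHypergraph r) → Subset (n X) → ℕ
degree X S = length (filterᵇ (λ e → isEdge X e ∧ does (S ⊆? e)) (allSubsets (n X)))

-- Δ(X): maximum over (r-1)-subsets S of V(X) of degree S (0 if there is none).
Δ : ∀ {r} → UniformHypergraph r → ℕ
Δ {r} X = foldr _⊔_ 0
  (map (degree X) (filterᵇ (λ S → does (∣ S ∣ ℕ.≟ (r ∸ 1))) (allSubsets (n X))))

-- Number of vertices u in the part V_i = f⁻¹(i) with S ∪ {u} ∈ E(X).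
partDegree : ∀ {r k} (X : UniformHypergraph r) → (Fin (n X) → Fin k) →
             Subset (n X) → Fin k → ℕ
partDegree X f S i =
  length (filterᵇ (λ u → does (f u ≟ i) ∧ isEdge X (S ∪ ⁅ u ⁆)) (allVertices (n X)))

partSize : ∀ {m k} → (Fin m → Fin k) → Fin k → ℕ
partSize {m} f i = length (filterᵇ (λ u → does (f u ≟ i)) (allVertices m))

expTerm : ℚ → ℕ → ℚ
expTerm a zero    = 1ℚ
expTerm a (suc j) = expTerm a j * a * ((+ 1) / suc j)

expPartial : ℚ → ℕ → ℚ
expPartial a zero    = 1ℚ
expPartial a (suc N) = expPartial a N + expTerm a (suc N)

-- For a ≥ 0 the partial sums increase to exp(a), so
-- exp(a) ≥ M  iff  for every ε > 0 some partial sum is ≥ M - ε.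
ExpAtLeast : ℚ → ℚ → Set
ExpAtLeast a M = ∀ (ε : ℚ) → ε > 0ℚ → ∃[ N ] (M - ε ≤ expPartial a N)

module Submission where

-- For a uniformly random f : V → Fin K (K = k + 1) and any set D of vertices, E[2^|D ∩ f⁻¹(i)|] =
-- (1 + 1/K)^|D|. By the Markov inequality and a union bound over the events |V_i| > 2n/K and
-- |N(S) ∩ V_i| > 2Δ/K (K + K n^(r-1) events, with |N(S)| ≤ Δ ≤ n), it suffices that
-- 2K n^(r-1) (1 + 1/K)^x < 2^(2x/K) for x ∈ {n, Δ}. As x ≥ Δ, this follows from
-- 2K n^(r-1) ≤ exp(Δ/3K) ≤ (1 + 1/g)^(10Δ) with g + 1 = 30K, since (1 + 1/g)^(10K) (1 + 1/K)^K < 4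
-- (roughly e^(1/3) · e). The method of conditional expectations makes the argument constructive.

module Fractions where

  open import Data.Nat as ℕ using (suc; NonZero)
  import Data.Nat.Properties as ℕ
  open import Data.Integer as ℤ using (+_)
  import Data.Integer.Properties as ℤ
  open import Data.Rational using (_+_; _*_; _/_; _≤_; _<_; toℚᵘ)
  import Data.Rational.Properties as ℚ
  open import Data.Rational.Unnormalised as ℚᵘ using (mkℚᵘ; *≡*; *≤*; *<*)
  import Data.Rational.Unnormalised.Properties as ℚᵘ
  open import Relation.Binary.PropositionalEquality

  private
    toℚᵘ-+/ : ∀ a b → toℚᵘ ((+ a) / suc b) ℚᵘ.≃ mkℚᵘ (+ a) b
    toℚᵘ-+/ a b = ℚ.toℚᵘ-fromℚᵘ (mkℚᵘ (+ a) b)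

  +/-≡ : ∀ a b c d .{{_ : NonZero b}} .{{_ : NonZero d}} →
         a ℕ.* d ≡ c ℕ.* b → (+ a) / b ≡ (+ c) / d
  +/-≡ a (suc b) c (suc d) eq = ℚ.toℚᵘ-injective (begin
    toℚᵘ ((+ a) / suc b) ≈⟨ toℚᵘ-+/ a b ⟩
    mkℚᵘ (+ a) b         ≈⟨ *≡* (trans (sym (ℤ.pos-* a (suc d))) (trans (cong +_ eq) (ℤ.pos-* c (suc b)))) ⟩
    mkℚᵘ (+ c) d         ≈⟨ toℚᵘ-+/ c d ⟨
    toℚᵘ ((+ c) / suc d) ∎)
    where open ℚᵘ.≃-Reasoning

  +/-* : ∀ a b c d .{{_ : NonZero b}} .{{_ : NonZero d}} →
         (+ a) / b * ((+ c) / d) ≡ _/_ (+ (a ℕ.* c)) (b ℕ.* d) {{ℕ.m*n≢0 b d}}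
  +/-* a (suc b) c (suc d) = ℚ.toℚᵘ-injective (begin
    toℚᵘ ((+ a) / suc b * ((+ c) / suc d))        ≈⟨ ℚ.toℚᵘ-homo-* ((+ a) / suc b) ((+ c) / suc d) ⟩
    toℚᵘ ((+ a) / suc b) ℚᵘ.* toℚᵘ ((+ c) / suc d) ≈⟨ ℚᵘ.*-cong (toℚᵘ-+/ a b) (toℚᵘ-+/ c d) ⟩
    mkℚᵘ (+ a) b ℚᵘ.* mkℚᵘ (+ c) d                 ≈⟨ *≡* (cong (ℤ._* (+ (suc b ℕ.* suc d))) (sym (ℤ.pos-* a c))) ⟩
    mkℚᵘ (+ (a ℕ.* c)) (suc b ℕ.* suc d ℕ.∸ 1)      ≈⟨ toℚᵘ-+/ (a ℕ.* c) _ ⟨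
    toℚᵘ (+ (a ℕ.* c) / (suc b ℕ.* suc d))          ∎)
    where open ℚᵘ.≃-Reasoning

  +/-+ : ∀ a b c d .{{_ : NonZero b}} .{{_ : NonZero d}} →
         (+ a) / b + (+ c) / d ≡ _/_ (+ (a ℕ.* d ℕ.+ c ℕ.* b)) (b ℕ.* d) {{ℕ.m*n≢0 b d}}
  +/-+ a (suc b) c (suc d) = ℚ.toℚᵘ-injective (begin
    toℚᵘ ((+ a) / suc b + (+ c) / suc d)            ≈⟨ ℚ.toℚᵘ-homo-+ ((+ a) / suc b) ((+ c) / suc d) ⟩
    toℚᵘ ((+ a) / suc b) ℚᵘ.+ toℚᵘ ((+ c) / suc d) ≈⟨ ℚᵘ.+-cong (toℚᵘ-+/ a b) (toℚᵘ-+/ c d) ⟩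
    mkℚᵘ (+ a) b ℚᵘ.+ mkℚᵘ (+ c) d                 ≈⟨ *≡* (cong (ℤ._* (+ (suc b ℕ.* suc d))) numerator) ⟩
    mkℚᵘ (+ n) (suc b ℕ.* suc d ℕ.∸ 1)             ≈⟨ toℚᵘ-+/ n _ ⟨
    toℚᵘ (+ n / (suc b ℕ.* suc d))                 ∎)
    where
    open ℚᵘ.≃-Reasoning
    n = a ℕ.* suc d ℕ.+ c ℕ.* suc b
    numerator : + a ℤ.* + suc d ℤ.+ + c ℤ.* + suc b ≡ + n
    numerator = trans (cong₂ ℤ._+_ (sym (ℤ.pos-* a (suc d))) (sym (ℤ.pos-* c (suc b))))
                      (sym (ℤ.pos-+ (a ℕ.* suc d) (c ℕ.* suc b)))

  +/-≤⁺ : ∀ a b c d .{{_ : NonZero b}} .{{_ : NonZero d}} →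
          a ℕ.* d ℕ.≤ c ℕ.* b → (+ a) / b ≤ (+ c) / d
  +/-≤⁺ a (suc b) c (suc d) le = ℚ.toℚᵘ-cancel-≤ (begin
    toℚᵘ ((+ a) / suc b) ≃⟨ toℚᵘ-+/ a b ⟩
    mkℚᵘ (+ a) b         ≤⟨ *≤* (subst₂ ℤ._≤_ (ℤ.pos-* a (suc d)) (ℤ.pos-* c (suc b)) (ℤ.+≤+ le)) ⟩
    mkℚᵘ (+ c) d         ≃⟨ toℚᵘ-+/ c d ⟨
    toℚᵘ ((+ c) / suc d) ∎)
    where open ℚᵘ.≤-Reasoning

  +/-<⁺ : ∀ a b c d .{{_ : NonZero b}} .{{_ : NonZero d}} →
          a ℕ.* d ℕ.< c ℕ.* b → (+ a) / b < (+ c) / d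
  +/-<⁺ a (suc b) c (suc d) lt = ℚ.toℚᵘ-cancel-< (begin-strict
    toℚᵘ ((+ a) / suc b) ≃⟨ toℚᵘ-+/ a b ⟩
    mkℚᵘ (+ a) b         <⟨ *<* (subst₂ ℤ._<_ (ℤ.pos-* a (suc d)) (ℤ.pos-* c (suc b)) (ℤ.+<+ lt)) ⟩
    mkℚᵘ (+ c) d         ≃⟨ toℚᵘ-+/ c d ⟨
    toℚᵘ ((+ c) / suc d) ∎)
    where open ℚᵘ.≤-Reasoning

  +/-≤⁻ : ∀ a b c d .{{_ : NonZero b}} .{{_ : NonZero d}} →
          (+ a) / b ≤ (+ c) / d → a ℕ.* d ℕ.≤ c ℕ.* b
  +/-≤⁻ a (suc b) c (suc d) le
    with ℚᵘ.≤-respʳ-≃ (toℚᵘ-+/ c d) (ℚᵘ.≤-respˡ-≃ (toℚᵘ-+/ a b) (ℚ.toℚᵘ-mono-≤ le))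
  ... | *≤* cross = ℤ.drop‿+≤+ (subst₂ ℤ._≤_ (sym (ℤ.pos-* a (suc d))) (sym (ℤ.pos-* c (suc b))) cross)

module ExponentialSeries where

  open import Data.Nat as ℕ using (ℕ; zero; suc; _^_)
  import Data.Nat.Properties as ℕ
  open import Data.Integer using (+_)
  open import Data.Rational using (0ℚ; 1ℚ; _+_; _*_; _-_; -_; _/_; _≤_; nonNegative)
  import Data.Rational.Properties as ℚ
  open import Data.Rational.Solver using (module +-*-Solver)
  open import Data.Nat.Tactic.RingSolver using (solve-∀)
  open import Data.Product using (proj₁; proj₂)
  open import Relation.Binary.PropositionalEquality
  open import Defs using (expTerm; expPartial; ExpAtLeast)
  open +-*-Solver
  open Fractions

  private
    *-monoˡ-≤ : ∀ {a b} r → 0ℚ ≤ r → a ≤ b → a * r ≤ b * r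
    *-monoˡ-≤ r 0≤r = ℚ.*-monoʳ-≤-nonNeg r {{nonNegative 0≤r}}

    *-mono-≤ : ∀ {a b y x} → 0ℚ ≤ b → 0ℚ ≤ y → a ≤ b → y ≤ x → a * y ≤ b * x
    *-mono-≤ {b = b} {y = y} 0≤b 0≤y a≤b y≤x =
      ℚ.≤-trans (*-monoˡ-≤ y 0≤y a≤b) (ℚ.*-monoˡ-≤-nonNeg b {{nonNegative 0≤b}} y≤x)

    nonNeg-* : ∀ {a b} → 0ℚ ≤ a → 0ℚ ≤ b → 0ℚ ≤ a * b
    nonNeg-* {a} {b} 0≤a 0≤b = subst (_≤ a * b) (ℚ.*-zeroˡ b) (*-monoˡ-≤ b 0≤b 0≤a)

    0≤1/suc : ∀ j → 0ℚ ≤ (+ 1) / suc j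
    0≤1/suc j = +/-≤⁺ 0 1 1 (suc j) ℕ.z≤n

  expTerm-nonNeg : ∀ {a} → 0ℚ ≤ a → ∀ j → 0ℚ ≤ expTerm a j
  expTerm-nonNeg 0≤a zero    = 0≤1/suc 0
  expTerm-nonNeg 0≤a (suc j) = nonNeg-* (nonNeg-* (expTerm-nonNeg 0≤a j) 0≤a) (0≤1/suc j)

  expTerm-mono : ∀ {a b} → 0ℚ ≤ a → a ≤ b → ∀ j → expTerm a j ≤ expTerm b j
  expTerm-mono 0≤a a≤b zero    = ℚ.≤-refl
  expTerm-mono 0≤a a≤b (suc j) = *-monoˡ-≤ _ (0≤1/suc j)
    (*-mono-≤ (expTerm-nonNeg (ℚ.≤-trans 0≤a a≤b) j) 0≤a (expTerm-mono 0≤a a≤b j) a≤b)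

  private
    1/[2+j]*[1/[1+j]+1] : ∀ j → (+ 1) / suc (suc j) * ((+ 1) / suc j + 1ℚ) ≡ (+ 1) / suc j
    1/[2+j]*[1/[1+j]+1] j = begin
      (+ 1) / suc (suc j) * ((+ 1) / suc j + 1ℚ)               ≡⟨ cong ((+ 1) / suc (suc j) *_) (+/-+ 1 (suc j) 1 1) ⟩
      (+ 1) / suc (suc j) * ((+ n) / (suc j ℕ.* 1))            ≡⟨ +/-* 1 (suc (suc j)) n (suc j ℕ.* 1) ⟩
      (+ (1 ℕ.* n)) / (suc (suc j) ℕ.* (suc j ℕ.* 1))          ≡⟨ +/-≡ (1 ℕ.* n) (suc (suc j) ℕ.* (suc j ℕ.* 1))
                                                                      1 (suc j) (cross j) ⟩
      (+ 1) / suc j                                            ∎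
      where
      open ≡-Reasoning
      n = 1 ℕ.* 1 ℕ.+ 1 ℕ.* suc j
      cross : ∀ j → 1 ℕ.* (1 ℕ.* 1 ℕ.+ 1 ℕ.* suc j) ℕ.* suc j ≡ 1 ℕ.* (suc (suc j) ℕ.* (suc j ℕ.* 1))
      cross = solve-∀

  -- (a + y)^(j+1) ≤ a^(j+1) + (j+1) y (a + y)^j, divided by (j+1)!.
  expTerm-+-≤ : ∀ {a y} → 0ℚ ≤ a → 0ℚ ≤ y → ∀ j →
                expTerm (a + y) (suc j) ≤ expTerm a (suc j) + y * expTerm (a + y) j
  expTerm-+-≤ {a} {y} 0≤a 0≤y zero = ℚ.≤-reflexive
    (solve 2 (λ a y → con 1ℚ :* (a :+ y) :* con 1ℚ := con 1ℚ :* a :* con 1ℚ :+ y :* con 1ℚ) refl a y)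
  expTerm-+-≤ {a} {y} 0≤a 0≤y (suc j) = begin
    expTerm s (suc j) * s * q₂                  ≤⟨ *-monoˡ-≤ q₂ (0≤1/suc (suc j))
                                                    (*-monoˡ-≤ s 0≤s (expTerm-+-≤ 0≤a 0≤y j)) ⟩
    (Ta + y * Tb) * s * q₂                      ≡⟨ solve 5 (λ Ta y Tb a q₂ →
                                                     (Ta :+ y :* Tb) :* (a :+ y) :* q₂
                                                     := Ta :* a :* q₂ :+ (Ta :* y :* q₂ :+ y :* Tb :* (a :+ y) :* q₂))
                                                     refl Ta y Tb a q₂ ⟩
    Ta * a * q₂ + (Ta * y * q₂ + y * Tb * s * q₂)
      ≤⟨ ℚ.+-monoʳ-≤ (Ta * a * q₂) (ℚ.+-monoˡ-≤ (y * Tb * s * q₂)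
           (*-monoˡ-≤ q₂ (0≤1/suc (suc j)) (*-monoˡ-≤ y 0≤y (expTerm-mono 0≤a a≤s (suc j))))) ⟩
    Ta * a * q₂ + (Tb * s * q₁ * y * q₂ + y * Tb * s * q₂)
      ≡⟨ cong (λ z → Ta * a * q₂ + z) (solve 5 (λ Tb s q₁ y q₂ →
           Tb :* s :* q₁ :* y :* q₂ :+ y :* Tb :* s :* q₂ := y :* (Tb :* s) :* (q₂ :* (q₁ :+ con 1ℚ)))
           refl Tb s q₁ y q₂) ⟩
    Ta * a * q₂ + y * (Tb * s) * (q₂ * (q₁ + 1ℚ))
      ≡⟨ cong (λ z → Ta * a * q₂ + y * (Tb * s) * z) (1/[2+j]*[1/[1+j]+1] j) ⟩
    Ta * a * q₂ + y * (Tb * s) * q₁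
      ≡⟨ cong (λ z → Ta * a * q₂ + z) (ℚ.*-assoc y (Tb * s) q₁) ⟩
    expTerm a (suc (suc j)) + y * expTerm s (suc j) ∎
    where
    open ℚ.≤-Reasoning
    s = a + y
    0≤s : 0ℚ ≤ s
    0≤s = ℚ.+-mono-≤ 0≤a 0≤y
    a≤s : a ≤ s
    a≤s = subst (_≤ s) (ℚ.+-identityʳ a) (ℚ.+-monoʳ-≤ a 0≤y)
    q₁ = (+ 1) / suc j
    q₂ = (+ 1) / suc (suc j)
    Ta = expTerm a (suc j)
    Tb = expTerm s j

  private
    expPartial-+-suc-≤ : ∀ {a y} → 0ℚ ≤ a → 0ℚ ≤ y → ∀ N →
      expPartial (a + y) (suc N) ≤ expPartial a (suc N) + y * expPartial (a + y) N
    expPartial-+-suc-≤ {a} {y} 0≤a 0≤y zero = begin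
      1ℚ + expTerm (a + y) 1               ≤⟨ ℚ.+-monoʳ-≤ 1ℚ (expTerm-+-≤ 0≤a 0≤y 0) ⟩
      1ℚ + (expTerm a 1 + y * 1ℚ)          ≡⟨ ℚ.+-assoc 1ℚ (expTerm a 1) (y * 1ℚ) ⟨
      1ℚ + expTerm a 1 + y * 1ℚ            ∎
      where open ℚ.≤-Reasoning
    expPartial-+-suc-≤ {a} {y} 0≤a 0≤y (suc N) = begin
      expPartial s (suc N) + expTerm s (suc (suc N))
        ≤⟨ ℚ.+-mono-≤ (expPartial-+-suc-≤ 0≤a 0≤y N) (expTerm-+-≤ 0≤a 0≤y (suc N)) ⟩
      (expPartial a (suc N) + y * expPartial s N) + (expTerm a (suc (suc N)) + y * expTerm s (suc N))
        ≡⟨ solve 5 (λ A y E T U → (A :+ y :* E) :+ (T :+ y :* U) := (A :+ T) :+ y :* (E :+ U)) refl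
             (expPartial a (suc N)) y (expPartial s N) (expTerm a (suc (suc N))) (expTerm s (suc N)) ⟩
      expPartial a (suc (suc N)) + y * expPartial s (suc N) ∎
      where
      open ℚ.≤-Reasoning
      s = a + y

    expPartial-+-≤ : ∀ {a y} → 0ℚ ≤ a → 0ℚ ≤ y → ∀ N →
      expPartial (a + y) N ≤ expPartial a N + y * expPartial (a + y) N
    expPartial-+-≤ {a} {y} 0≤a 0≤y zero = begin
      1ℚ            ≡⟨ ℚ.+-identityʳ 1ℚ ⟨
      1ℚ + 0ℚ       ≤⟨ ℚ.+-monoʳ-≤ 1ℚ (nonNeg-* 0≤y (0≤1/suc 0)) ⟩
      1ℚ + y * 1ℚ   ∎
      where open ℚ.≤-Reasoning
    expPartial-+-≤ {a} {y} 0≤a 0≤y (suc N) = begin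
      expPartial s (suc N)                          ≤⟨ expPartial-+-suc-≤ 0≤a 0≤y N ⟩
      expPartial a (suc N) + y * expPartial s N     ≤⟨ ℚ.+-monoʳ-≤ (expPartial a (suc N))
                                                         (ℚ.*-monoˡ-≤-nonNeg y {{nonNegative 0≤y}} E≤E′) ⟩
      expPartial a (suc N) + y * expPartial s (suc N) ∎
      where
      open ℚ.≤-Reasoning
      s = a + y
      E≤E′ : expPartial s N ≤ expPartial s (suc N)
      E≤E′ = subst (_≤ expPartial s (suc N)) (ℚ.+-identityʳ (expPartial s N))
               (ℚ.+-monoʳ-≤ (expPartial s N) (expTerm-nonNeg (ℚ.+-mono-≤ 0≤a 0≤y) (suc N)))

  expPartial-+-*-≤ : ∀ {a y} → 0ℚ ≤ a → 0ℚ ≤ y → ∀ N → expPartial (a + y) N * (1ℚ - y) ≤ expPartial a N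
  expPartial-+-*-≤ {a} {y} 0≤a 0≤y N = begin
    E * (1ℚ - y)       ≡⟨ solve 2 (λ E y → E :* (con 1ℚ :- y) := E :- y :* E) refl E y ⟩
    E - y * E          ≤⟨ ℚ.+-monoˡ-≤ (- (y * E)) (expPartial-+-≤ 0≤a 0≤y N) ⟩
    A + y * E - y * E  ≡⟨ solve 3 (λ A y E → A :+ y :* E :- y :* E := A) refl A y E ⟩
    A                  ∎
    where
    open ℚ.≤-Reasoning
    E = expPartial (a + y) N
    A = expPartial a N

  private
    expPartial-0 : ∀ N → expPartial 0ℚ N ≡ 1ℚ
    expPartial-0 zero    = refl
    expPartial-0 (suc N) = trans (cong₂ _+_ (expPartial-0 N) expTerm-0) (ℚ.+-identityʳ 1ℚ)
      where
      expTerm-0 : expTerm 0ℚ (suc N) ≡ 0ℚ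
      expTerm-0 = trans (cong (_* ((+ 1) / suc N)) (ℚ.*-zeroʳ (expTerm 0ℚ N))) (ℚ.*-zeroˡ ((+ 1) / suc N))

    1-1/suc : ∀ g → 1ℚ - (+ 1) / suc g ≡ (+ g) / suc g
    1-1/suc g = begin
      1ℚ - y        ≡⟨ cong (_- y) sum≡1 ⟨
      (x + y) - y   ≡⟨ solve 2 (λ x y → (x :+ y) :- y := x) refl x y ⟩
      x             ∎
      where
      open ≡-Reasoning
      x = (+ g) / suc g
      y = (+ 1) / suc g
      cross : ∀ g → (g ℕ.* suc g ℕ.+ 1 ℕ.* suc g) ℕ.* 1 ≡ 1 ℕ.* (suc g ℕ.* suc g)
      cross = solve-∀
      sum≡1 : x + y ≡ 1ℚ
      sum≡1 = trans (+/-+ g (suc g) 1 (suc g)) (+/-≡ (g ℕ.* suc g ℕ.+ 1 ℕ.* suc g) (suc g ℕ.* suc g) 1 1 (cross g))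

  -- exp (M / (g + 1)) ≤ (1 + 1/g)^M
  expPartial-/-≤ : ∀ g M N → expPartial ((+ M) / suc g) N * ((+ (g ^ M)) / 1) ≤ (+ (suc g ^ M)) / 1
  expPartial-/-≤ g zero N = ℚ.≤-reflexive (begin
    expPartial ((+ 0) / suc g) N * 1ℚ ≡⟨ ℚ.*-identityʳ _ ⟩
    expPartial ((+ 0) / suc g) N      ≡⟨ cong (λ z → expPartial z N) (+/-≡ 0 (suc g) 0 1 refl) ⟩
    expPartial 0ℚ N                   ≡⟨ expPartial-0 N ⟩
    1ℚ                                ∎)
    where open ≡-Reasoning
  expPartial-/-≤ g (suc M) N = begin
    expPartial ((+ suc M) / suc g) N * ((+ (g ^ suc M)) / 1)
      ≡⟨ cong₂ (λ z w → expPartial z N * w) M+1/g+1 split ⟩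
    expPartial (x + y) N * ((1ℚ - y) * (S * G))
      ≡⟨ ℚ.*-assoc (expPartial (x + y) N) (1ℚ - y) (S * G) ⟨
    expPartial (x + y) N * (1ℚ - y) * (S * G)
      ≤⟨ *-monoˡ-≤ (S * G) 0≤S*G (expPartial-+-*-≤ 0≤x (0≤1/suc g) N) ⟩
    expPartial x N * (S * G)
      ≡⟨ solve 3 (λ E S G → E :* (S :* G) := E :* G :* S) refl (expPartial x N) S G ⟩
    expPartial x N * G * S
      ≤⟨ *-monoˡ-≤ S 0≤S (expPartial-/-≤ g M N) ⟩
    (+ (suc g ^ M)) / 1 * S
      ≡⟨ trans (+/-* (suc g ^ M) 1 (suc g) 1) (+/-≡ (suc g ^ M ℕ.* suc g) 1 (suc g ^ suc M) 1 (power g (suc g ^ M))) ⟩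
    (+ (suc g ^ suc M)) / 1 ∎
    where
    open ℚ.≤-Reasoning
    x = (+ M) / suc g
    y = (+ 1) / suc g
    S = (+ suc g) / 1
    G = (+ (g ^ M)) / 1
    power : ∀ g p → p ℕ.* suc g ℕ.* 1 ≡ suc g ℕ.* p ℕ.* 1
    power = solve-∀
    0≤x : 0ℚ ≤ x
    0≤x = +/-≤⁺ 0 1 M (suc g) ℕ.z≤n
    0≤S : 0ℚ ≤ S
    0≤S = +/-≤⁺ 0 1 (suc g) 1 ℕ.z≤n
    0≤S*G : 0ℚ ≤ S * G
    0≤S*G = nonNeg-* 0≤S (+/-≤⁺ 0 1 (g ^ M) 1 ℕ.z≤n)
    M+1/g+1 : (+ suc M) / suc g ≡ x + y
    M+1/g+1 = sym (trans (+/-+ M (suc g) 1 (suc g))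
                         (+/-≡ (M ℕ.* suc g ℕ.+ 1 ℕ.* suc g) (suc g ℕ.* suc g) (suc M) (suc g) (cross M g)))
      where
      cross : ∀ M g → (M ℕ.* suc g ℕ.+ 1 ℕ.* suc g) ℕ.* suc g ≡ suc M ℕ.* (suc g ℕ.* suc g)
      cross = solve-∀
    split : (+ (g ^ suc M)) / 1 ≡ (1ℚ - y) * (S * G)
    split = sym (begin-equality
      (1ℚ - y) * (S * G)                                 ≡⟨ cong (_* (S * G)) (1-1/suc g) ⟩
      (+ g) / suc g * (S * G)                            ≡⟨ cong ((+ g) / suc g *_) (+/-* (suc g) 1 (g ^ M) 1) ⟩
      (+ g) / suc g * ((+ (suc g ℕ.* g ^ M)) / 1)        ≡⟨ +/-* g (suc g) (suc g ℕ.* g ^ M) 1 ⟩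
      (+ (g ℕ.* (suc g ℕ.* g ^ M))) / (suc g ℕ.* 1)      ≡⟨ +/-≡ (g ℕ.* (suc g ℕ.* g ^ M)) (suc g ℕ.* 1) (g ^ suc M) 1
                                                                  (cross g (g ^ M)) ⟩
      (+ (g ^ suc M)) / 1                                ∎)
      where
      cross : ∀ g p → g ℕ.* (suc g ℕ.* p) ℕ.* 1 ≡ g ℕ.* p ℕ.* (suc g ℕ.* 1)
      cross = solve-∀

  private
    ≤-of-integral : ∀ p A B → p ℕ.* suc B ℕ.≤ A ℕ.* suc B ℕ.+ B → p ℕ.≤ A
    ≤-of-integral p A B le = ℕ.≮⇒≥ λ A<p → ℕ.<⇒≱ (begin-strict
      A ℕ.* suc B ℕ.+ B       <⟨ ℕ.+-monoʳ-< (A ℕ.* suc B) ℕ.≤-refl ⟩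
      A ℕ.* suc B ℕ.+ suc B   ≡⟨ ℕ.+-comm (A ℕ.* suc B) (suc B) ⟩
      suc A ℕ.* suc B         ≤⟨ ℕ.*-monoˡ-≤ (suc B) A<p ⟩
      p ℕ.* suc B             ∎) le
      where open ℕ.≤-Reasoning

  -- Taking ε = 1 / (g^M + 1) makes ε g^M < 1, so the integer c g^M exceeds (g+1)^M by less than 1.
  expAtLeast⇒*-^-≤ : ∀ g M c → ExpAtLeast ((+ M) / suc g) ((+ c) / 1) → c ℕ.* g ^ M ℕ.≤ suc g ^ M
  expAtLeast⇒*-^-≤ g M c H = ≤-of-integral (c ℕ.* B) A B (subst₂ ℕ._≤_ (lhs c B) (rhs A B) cross)
    where
    A = suc g ^ M
    B = g ^ M
    ε = (+ 1) / suc B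
    c′ = (+ c) / 1
    A′ = (+ A) / 1
    B′ = (+ B) / 1
    N = proj₁ (H ε (+/-<⁺ 0 1 1 (suc B) (ℕ.s≤s ℕ.z≤n)))
    c-ε≤E : c′ - ε ≤ expPartial ((+ M) / suc g) N
    c-ε≤E = proj₂ (H ε (+/-<⁺ 0 1 1 (suc B) (ℕ.s≤s ℕ.z≤n)))
    cB≤A+εB : c′ * B′ ≤ A′ + ε * B′
    cB≤A+εB = begin
      c′ * B′                   ≡⟨ solve 3 (λ c e B → c :* B := (c :- e) :* B :+ e :* B) refl c′ ε B′ ⟩
      (c′ - ε) * B′ + ε * B′    ≤⟨ ℚ.+-monoˡ-≤ (ε * B′) (ℚ.≤-trans
                                     (*-monoˡ-≤ B′ (+/-≤⁺ 0 1 B 1 ℕ.z≤n) c-ε≤E) (expPartial-/-≤ g M N)) ⟩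
      A′ + ε * B′               ∎
      where open ℚ.≤-Reasoning
    cross : c ℕ.* B ℕ.* (1 ℕ.* (suc B ℕ.* 1)) ℕ.≤ (A ℕ.* (suc B ℕ.* 1) ℕ.+ 1 ℕ.* B ℕ.* 1) ℕ.* (1 ℕ.* 1)
    cross = +/-≤⁻ (c ℕ.* B) (1 ℕ.* 1) (A ℕ.* (suc B ℕ.* 1) ℕ.+ 1 ℕ.* B ℕ.* 1) (1 ℕ.* (suc B ℕ.* 1))
      (subst₂ _≤_ (+/-* c 1 B 1) (trans (cong (λ z → A′ + z) (+/-* 1 (suc B) B 1)) (+/-+ A 1 (1 ℕ.* B) (suc B ℕ.* 1)))
        cB≤A+εB)
    lhs : ∀ c B → c ℕ.* B ℕ.* (1 ℕ.* (suc B ℕ.* 1)) ≡ c ℕ.* B ℕ.* suc B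
    lhs = solve-∀
    rhs : ∀ A B → (A ℕ.* (suc B ℕ.* 1) ℕ.+ 1 ℕ.* B ℕ.* 1) ℕ.* (1 ℕ.* 1) ≡ A ℕ.* suc B ℕ.+ B
    rhs = solve-∀

module EulerRatios where

  open import Data.Nat
  open import Data.Nat.Properties
  open import Relation.Binary.PropositionalEquality
  open import Data.Fin using (Fin; toℕ; fromℕ<)
  open import Data.Fin.Properties using (all?; toℕ-fromℕ<)
  open import Data.Sum using ([_,_]′)
  open import Relation.Nullary.Decidable using (toWitness)
  open import Data.Nat.Tactic.RingSolver using (solve-∀)

  ^-distribʳ-* : ∀ m n p → (m * n) ^ p ≡ m ^ p * n ^ p
  ^-distribʳ-* m n zero    = refl
  ^-distribʳ-* m n (suc p) = trans (cong ((m * n) *_) (^-distribʳ-* m n p)) (interchange m n (m ^ p) (n ^ p))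
    where
    interchange : ∀ m n a b → m * n * (a * b) ≡ m * a * (n * b)
    interchange = solve-∀

  binomial-≤ : ∀ A n → A ^ suc n + suc n * A ^ n ≤ suc A ^ suc n
  binomial-≤ A zero = ≤-reflexive (identity A)
    where
    identity : ∀ A → A * 1 + 1 * 1 ≡ suc A * 1
    identity = solve-∀
  binomial-≤ A (suc n) = begin
    A * (A * A ^ n) + suc (suc n) * (A * A ^ n)                  ≤⟨ m≤m+n _ (A ^ n * suc n) ⟩
    A * (A * A ^ n) + suc (suc n) * (A * A ^ n) + A ^ n * suc n  ≡⟨ identity A n (A ^ n) ⟩
    suc A * (A * A ^ n + suc n * A ^ n)                          ≤⟨ *-monoʳ-≤ (suc A) (binomial-≤ A n) ⟩
    suc A * suc A ^ suc n                                        ∎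
    where
    open ≤-Reasoning
    identity : ∀ A n p → A * (A * p) + suc (suc n) * (A * p) + p * suc n ≡ suc A * (A * p + suc n * p)
    identity = solve-∀

  -- Ratios are compared cross-multiplied. With e m = (1 + 1/m)^(m+1), this says e (m + 1) ≤ e m.
  euler-ratio-step : ∀ m → suc (suc m) ^ suc (suc m) * m ^ suc m ≤ suc m ^ suc (suc m) * suc m ^ suc m
  euler-ratio-step m = begin
    suc (suc m) ^ suc (suc m) * m ^ suc m   ≡⟨ lhs ⟩
    suc (suc m) * (A ^ m * A)               ≤⟨ m≤m+n _ (A ^ m) ⟩
    suc (suc m) * (A ^ m * A) + A ^ m       ≡⟨ regroup m (A ^ m) ⟩
    suc m * (A * A ^ m + suc m * A ^ m)     ≤⟨ *-monoʳ-≤ (suc m) (binomial-≤ A m) ⟩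
    suc m * suc A ^ suc m                   ≡⟨ rhs ⟩
    suc m ^ suc (suc m) * suc m ^ suc m     ∎
    where
    open ≤-Reasoning
    A = m * suc (suc m)
    regroup : ∀ m p → suc (suc m) * (p * (m * suc (suc m))) + p ≡ suc m * ((m * suc (suc m)) * p + suc m * p)
    regroup = solve-∀
    suc-A : ∀ m → suc (m * suc (suc m)) ≡ suc m * suc m
    suc-A = solve-∀
    lhs : suc (suc m) ^ suc (suc m) * m ^ suc m ≡ suc (suc m) * (A ^ m * A)
    lhs = begin-equality
      suc (suc m) * suc (suc m) ^ suc m * m ^ suc m   ≡⟨ *-assoc (suc (suc m)) (suc (suc m) ^ suc m) (m ^ suc m) ⟩
      suc (suc m) * (suc (suc m) ^ suc m * m ^ suc m) ≡⟨ cong (suc (suc m) *_) (^-distribʳ-* (suc (suc m)) m (suc m)) ⟨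
      suc (suc m) * (suc (suc m) * m) ^ suc m         ≡⟨ cong (λ z → suc (suc m) * z ^ suc m) (*-comm (suc (suc m)) m) ⟩
      suc (suc m) * (A * A ^ m)                       ≡⟨ cong (suc (suc m) *_) (*-comm A (A ^ m)) ⟩
      suc (suc m) * (A ^ m * A)                       ∎
    rhs : suc m * suc A ^ suc m ≡ suc m ^ suc (suc m) * suc m ^ suc m
    rhs = begin-equality
      suc m * suc A ^ suc m                   ≡⟨ cong (λ z → suc m * z ^ suc m) (suc-A m) ⟩
      suc m * (suc m * suc m) ^ suc m         ≡⟨ cong (suc m *_) (^-distribʳ-* (suc m) (suc m) (suc m)) ⟩
      suc m * (suc m ^ suc m * suc m ^ suc m) ≡⟨ *-assoc (suc m) (suc m ^ suc m) (suc m ^ suc m) ⟨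
      suc m ^ suc (suc m) * suc m ^ suc m     ∎

  -- e m ≤ e (b + 1)
  euler-ratio-antitone : ∀ {b m} → suc b ≤′ m →
    suc m ^ suc m * suc b ^ suc (suc b) ≤ suc (suc b) ^ suc (suc b) * m ^ suc m
  euler-ratio-antitone ≤′-refl = ≤-refl
  euler-ratio-antitone {b} {suc m} (≤′-step b<m) = *-cancelʳ-≤ _ _ (m ^ suc m) {{m^n≢0 m (suc m)}} (begin
    suc (suc m) ^ suc (suc m) * c * m ^ suc m    ≡⟨ swap (suc (suc m) ^ suc (suc m)) c (m ^ suc m) ⟩
    suc (suc m) ^ suc (suc m) * m ^ suc m * c    ≤⟨ *-monoˡ-≤ c (euler-ratio-step m) ⟩
    suc m ^ suc (suc m) * suc m ^ suc m * c      ≡⟨ *-assoc (suc m ^ suc (suc m)) (suc m ^ suc m) c ⟩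
    suc m ^ suc (suc m) * (suc m ^ suc m * c)    ≤⟨ *-monoʳ-≤ (suc m ^ suc (suc m)) (euler-ratio-antitone b<m) ⟩
    suc m ^ suc (suc m) * (C * m ^ suc m)        ≡⟨ swap′ (suc m ^ suc (suc m)) C (m ^ suc m) ⟩
    C * suc m ^ suc (suc m) * m ^ suc m          ∎)
    where
    open ≤-Reasoning
    instance
      _ : NonZero m
      _ = >-nonZero (≤-trans (s≤s z≤n) (≤′⇒≤ b<m))
    c = suc b ^ suc (suc b)
    C = suc (suc b) ^ suc (suc b)
    swap : ∀ x y z → x * y * z ≡ x * z * y
    swap = solve-∀
    swap′ : ∀ x y z → x * (y * z) ≡ y * x * z
    swap′ = solve-∀

  -- (1 + 1/K)^K ≤ e 12
  one-plus-inv-^-≤ : ∀ k → suc (suc k) ^ suc k * 12 ^ 13 ≤ 13 ^ 13 * suc k ^ suc k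
  one-plus-inv-^-≤ k = [ small , large ]′ (<-≤-connex k 11)
    where
    Bound : ℕ → Set
    Bound k = suc (suc k) ^ suc k * 12 ^ 13 ≤ 13 ^ 13 * suc k ^ suc k
    checked : ∀ (i : Fin 11) → Bound (toℕ i)
    checked = toWitness {a? = all? (λ i → _ ≤? _)} _
    small : k < 11 → Bound k
    small k<11 = subst Bound (toℕ-fromℕ< k<11) (checked (fromℕ< k<11))
    large : 11 ≤ k → Bound k
    large 11≤k = *-cancelʳ-≤ _ _ K (begin
      suc K ^ K * 12 ^ 13 * K     ≡⟨ swap (suc K ^ K) (12 ^ 13) K ⟩
      K * suc K ^ K * 12 ^ 13     ≤⟨ *-monoˡ-≤ (12 ^ 13) (*-monoˡ-≤ (suc K ^ K) (n≤1+n K)) ⟩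
      suc K ^ suc K * 12 ^ 13     ≤⟨ euler-ratio-antitone {11} {K} (≤⇒≤′ (s≤s 11≤k)) ⟩
      13 ^ 13 * (K * K ^ K)       ≡⟨ swap′ (13 ^ 13) K (K ^ K) ⟩
      13 ^ 13 * K ^ K * K         ∎)
      where
      open ≤-Reasoning
      K = suc k
      swap : ∀ x y z → x * y * z ≡ z * x * y
      swap = solve-∀
      swap′ : ∀ x y z → x * (y * z) ≡ x * z * y
      swap′ = solve-∀

  private
    ^-cancelˡ-< : ∀ n {a b} → a ^ n < b ^ n → a < b
    ^-cancelˡ-< n {a} {b} lt = ≰⇒> λ b≤a → <⇒≱ lt (^-monoˡ-≤ n b≤a)

  -- e 29 · (e 12)^3 < 64
  euler-ratio-product-< : suc (suc 28) ^ suc (suc 28) * (13 ^ 13) ^ 3 < 64 * (suc 28 ^ suc (suc 28) * (12 ^ 13) ^ 3)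
  euler-ratio-product-< = toWitness {a? = _ <? _} _

  private
    cube-ratio-< : ∀ P Q u w a b c d → P * c ≤ a * Q → u * d ≤ b * w → a * b ^ 3 < 64 * (c * d ^ 3) →
                   .{{_ : NonZero (Q * w ^ 3)}} → P * u ^ 3 < 64 * (Q * w ^ 3)
    cube-ratio-< P Q u w a b c d Pc≤aQ ud≤bw ab³<64cd³ = *-cancelʳ-< (c * d ^ 3) _ _ (begin-strict
      P * u ^ 3 * (c * d ^ 3)         ≡⟨ regroup P u c d ⟩
      P * c * (u * d) ^ 3             ≤⟨ *-mono-≤ Pc≤aQ (^-monoˡ-≤ 3 ud≤bw) ⟩
      a * Q * (b * w) ^ 3             ≡⟨ regroup′ a Q b w ⟩
      Q * w ^ 3 * (a * b ^ 3)         <⟨ *-monoʳ-< (Q * w ^ 3) ab³<64cd³ ⟩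
      Q * w ^ 3 * (64 * (c * d ^ 3))  ≡⟨ regroup″ Q w c d ⟩
      64 * (Q * w ^ 3) * (c * d ^ 3)  ∎)
      where
      open ≤-Reasoning
      regroup : ∀ P u c d → P * (u * (u * (u * 1))) * (c * (d * (d * (d * 1))))
                            ≡ P * c * (u * d * (u * d * (u * d * 1)))
      regroup = solve-∀
      regroup′ : ∀ a Q b w → a * Q * (b * w * (b * w * (b * w * 1)))
                             ≡ Q * (w * (w * (w * 1))) * (a * (b * (b * (b * 1))))
      regroup′ = solve-∀
      regroup″ : ∀ Q w c d → Q * (w * (w * (w * 1))) * (64 * (c * (d * (d * (d * 1)))))
                             ≡ 64 * (Q * (w * (w * (w * 1)))) * (c * (d * (d * (d * 1))))
      regroup″ = solve-∀

  -- (1 + 1/g)^(10 K) (1 + 1/K)^K < 4 when g + 1 = 30 K: the cube of the left side is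
  -- (1 + 1/g)^(g + 1) ((1 + 1/K)^K)^3 ≤ e 29 · (e 12)^3.
  ratio-bound : ∀ g k → suc g ≡ 30 * suc k →
    suc g ^ (10 * suc k) * suc (suc k) ^ suc k < 4 * (g ^ (10 * suc k) * suc k ^ suc k)
  ratio-bound g k g+1≡30K = ^-cancelˡ-< 3 (begin-strict
    (suc g ^ n * suc K ^ K) ^ 3          ≡⟨ ^n*-cube (suc g) (suc K ^ K) ⟩
    suc g ^ suc g * (suc K ^ K) ^ 3      <⟨ cube-ratio-< (suc g ^ suc g) (g ^ suc g) (suc K ^ K) (K ^ K)
                                              (suc (suc 28) ^ suc (suc 28)) (13 ^ 13) (suc 28 ^ suc (suc 28)) (12 ^ 13)
                                              (euler-ratio-antitone {28} {g} (≤⇒≤′ 29≤g))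
                                              (one-plus-inv-^-≤ k) euler-ratio-product-< {{V³≢0}} ⟩
    64 * (g ^ suc g * (K ^ K) ^ 3)       ≡⟨ cong (64 *_) (^n*-cube g (K ^ K)) ⟨
    64 * (g ^ n * K ^ K) ^ 3             ≡⟨ ^-distribʳ-* 4 (g ^ n * K ^ K) 3 ⟨
    (4 * (g ^ n * K ^ K)) ^ 3            ∎)
    where
    open ≤-Reasoning
    K = suc k
    n = 10 * K
    29≤g : 29 ≤ g
    29≤g = s≤s⁻¹ (subst (30 ≤_) (sym g+1≡30K) (m≤m*n 30 K))
    instance
      _ : NonZero g
      _ = >-nonZero (≤-trans (s≤s z≤n) 29≤g)
    V³≢0 : NonZero (g ^ suc g * (K ^ K) ^ 3)
    V³≢0 = m*n≢0 _ _ {{m^n≢0 g (suc g)}} {{m^n≢0 (K ^ K) 3 {{m^n≢0 K K}}}}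
    n*3≡30K : ∀ k → 10 * suc k * 3 ≡ 30 * suc k
    n*3≡30K = solve-∀
    ^n*-cube : ∀ x y → (x ^ n * y) ^ 3 ≡ x ^ suc g * y ^ 3
    ^n*-cube x y = begin-equality
      (x ^ n * y) ^ 3       ≡⟨ ^-distribʳ-* (x ^ n) y 3 ⟩
      (x ^ n) ^ 3 * y ^ 3   ≡⟨ cong (_* y ^ 3) (^-*-assoc x n 3) ⟩
      x ^ (n * 3) * y ^ 3   ≡⟨ cong (λ e → x ^ e * y ^ 3) (trans (n*3≡30K k) (sym g+1≡30K)) ⟩
      x ^ suc g * y ^ 3     ∎

  private
    ^-split : ∀ a {i j} → i ≤ j → a ^ j ≡ a ^ i * a ^ (j ∸ i)
    ^-split a {i} i≤j = trans (cong (a ^_) (sym (m+[n∸m]≡n i≤j))) (^-distribˡ-+-* a i _)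

    cross-^-≤ : ∀ {u v i j} → v ≤ u → i ≤ j → u ^ i * v ^ j ≤ u ^ j * v ^ i
    cross-^-≤ {u} {v} {i} {j} v≤u i≤j = begin
      u ^ i * v ^ j               ≡⟨ cong (u ^ i *_) (^-split v i≤j) ⟩
      u ^ i * (v ^ i * v ^ d)     ≤⟨ *-monoʳ-≤ (u ^ i) (*-monoʳ-≤ (v ^ i) (^-monoˡ-≤ d v≤u)) ⟩
      u ^ i * (v ^ i * u ^ d)     ≡⟨ swap (u ^ i) (v ^ i) (u ^ d) ⟩
      u ^ i * u ^ d * v ^ i       ≡⟨ cong (_* v ^ i) (^-split u i≤j) ⟨
      u ^ j * v ^ i               ∎
      where
      open ≤-Reasoning
      d = j ∸ i
      swap : ∀ a b c → a * (b * c) ≡ a * c * b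
      swap = solve-∀

    10-^-* : ∀ a b e → (a ^ 10 * b) ^ e ≡ a ^ (10 * e) * b ^ e
    10-^-* a b e = trans (^-distribʳ-* (a ^ 10) b e) (cong (_* b ^ e) (^-*-assoc a 10 e))

  -- (u/v)^x = ((u/v)^K)^(x/K) < 4^(x/K) ≤ 2^(m+1)
  ^-<-2^-* : ∀ {u v} K x m .{{_ : NonZero v}} → v ≤ u → u ^ K < 4 * v ^ K → 2 * x < K * suc m →
             u ^ x < 2 ^ suc m * v ^ x
  ^-<-2^-* {u} {v} K x m v≤u uᴷ<4vᴷ 2x<j = ^-cancelˡ-< 2 (begin-strict
    (u ^ x) ^ 2                 ≡⟨ ^-*-assoc u x 2 ⟩
    u ^ i                       <⟨ *-cancelʳ-< (v ^ j) _ _ uⁱvʲ<4ᵐ⁺¹vⁱvʲ ⟩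
    4 ^ suc m * v ^ i             ≡⟨ cong (_* v ^ i) (^-*-assoc 2 2 (suc m)) ⟩
    2 ^ (2 * suc m) * v ^ i       ≡⟨ cong (λ e → 2 ^ e * v ^ i) (*-comm 2 (suc m)) ⟩
    2 ^ (suc m * 2) * v ^ (x * 2) ≡⟨ cong₂ _*_ (^-*-assoc 2 (suc m) 2) (^-*-assoc v x 2) ⟨
    (2 ^ suc m) ^ 2 * (v ^ x) ^ 2 ≡⟨ ^-distribʳ-* (2 ^ suc m) (v ^ x) 2 ⟨
    (2 ^ suc m * v ^ x) ^ 2       ∎)
    where
    open ≤-Reasoning
    i = x * 2
    j = K * suc m
    uʲ<4ᵐ⁺¹vʲ : u ^ j < 4 ^ suc m * v ^ j
    uʲ<4ᵐ⁺¹vʲ = begin-strict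
      u ^ j                        ≡⟨ ^-*-assoc u K (suc m) ⟨
      (u ^ K) ^ suc m              <⟨ ^-monoˡ-< (suc m) uᴷ<4vᴷ ⟩
      (4 * v ^ K) ^ suc m          ≡⟨ ^-distribʳ-* 4 (v ^ K) (suc m) ⟩
      4 ^ suc m * (v ^ K) ^ suc m  ≡⟨ cong (4 ^ suc m *_) (^-*-assoc v K (suc m)) ⟩
      4 ^ suc m * v ^ j            ∎
    uⁱvʲ<4ᵐ⁺¹vⁱvʲ : u ^ i * v ^ j < 4 ^ suc m * v ^ i * v ^ j
    uⁱvʲ<4ᵐ⁺¹vⁱvʲ = begin-strict
      u ^ i * v ^ j               ≤⟨ cross-^-≤ v≤u (<⇒≤ (subst (_< j) (*-comm 2 x) 2x<j)) ⟩
      u ^ j * v ^ i               <⟨ *-monoˡ-< (v ^ i) {{m^n≢0 v i}} uʲ<4ᵐ⁺¹vʲ ⟩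
      4 ^ suc m * v ^ j * v ^ i   ≡⟨ swap (4 ^ suc m) (v ^ j) (v ^ i) ⟩
      4 ^ suc m * v ^ i * v ^ j   ∎
      where
      swap : ∀ a b c → a * b * c ≡ a * c * b
      swap = solve-∀

  *-^-≤-^-mono : ∀ c g {i j} → i ≤ j → c * g ^ i ≤ suc g ^ i → c * g ^ j ≤ suc g ^ j
  *-^-≤-^-mono c g {i} {j} i≤j c*gⁱ≤ = begin
    c * g ^ j                      ≡⟨ cong (c *_) (^-split g i≤j) ⟩
    c * (g ^ i * g ^ (j ∸ i))      ≡⟨ *-assoc c (g ^ i) (g ^ (j ∸ i)) ⟨
    c * g ^ i * g ^ (j ∸ i)        ≤⟨ *-mono-≤ c*gⁱ≤ (^-monoˡ-≤ (j ∸ i) (n≤1+n g)) ⟩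
    suc g ^ i * suc g ^ (j ∸ i)    ≡⟨ ^-split (suc g) i≤j ⟨
    suc g ^ j                      ∎
    where open ≤-Reasoning

  -- A bound c ≤ (1 + 1/g)^(10 Δ) forces c (1 + 1/K)^x < 2^(m+1) for Δ ≤ x < K (m+1) / 2.
  *-^-<-2^-* : ∀ g k → suc g ≡ 30 * suc k → ∀ Δ x c m →
    c * g ^ (10 * Δ) ≤ suc g ^ (10 * Δ) → Δ ≤ x → 2 * x < suc k * suc m →
    c * suc (suc k) ^ x < 2 ^ suc m * suc k ^ x
  *-^-<-2^-* g k g+1≡30K Δ x c m c≤ Δ≤x 2x< = *-cancelʳ-< (g ^ (10 * x)) _ _ (begin-strict
    c * suc K ^ x * g ^ (10 * x)       ≡⟨ swap c (suc K ^ x) (g ^ (10 * x)) ⟩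
    c * g ^ (10 * x) * suc K ^ x       ≤⟨ *-monoˡ-≤ (suc K ^ x) (*-^-≤-^-mono c g (*-monoʳ-≤ 10 Δ≤x) c≤) ⟩
    suc g ^ (10 * x) * suc K ^ x       ≡⟨ 10-^-* (suc g) (suc K) x ⟨
    (suc g ^ 10 * suc K) ^ x           <⟨ ^-<-2^-* K x m v≤u uᴷ<4vᴷ 2x< ⟩
    2 ^ suc m * (g ^ 10 * K) ^ x       ≡⟨ cong (2 ^ suc m *_) (10-^-* g K x) ⟩
    2 ^ suc m * (g ^ (10 * x) * K ^ x) ≡⟨ swap′ (2 ^ suc m) (g ^ (10 * x)) (K ^ x) ⟩
    2 ^ suc m * K ^ x * g ^ (10 * x)   ∎)
    where
    open ≤-Reasoning
    K = suc k
    instance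
      _ : NonZero g
      _ = >-nonZero (s≤s⁻¹ (subst (2 ≤_) (sym g+1≡30K) (≤-trans (s≤s (s≤s z≤n)) (m≤m*n 30 K))))
      _ : NonZero (g ^ (10 * x))
      _ = m^n≢0 g (10 * x)
      _ : NonZero (g ^ 10 * K)
      _ = m*n≢0 (g ^ 10) K {{m^n≢0 g 10}}
    v≤u : g ^ 10 * K ≤ suc g ^ 10 * suc K
    v≤u = *-mono-≤ (^-monoˡ-≤ 10 (n≤1+n g)) (n≤1+n K)
    uᴷ<4vᴷ : (suc g ^ 10 * suc K) ^ K < 4 * (g ^ 10 * K) ^ K
    uᴷ<4vᴷ = subst₂ (λ a b → a < 4 * b) (sym (10-^-* (suc g) (suc K) K)) (sym (10-^-* g K K)) (ratio-bound g k g+1≡30K)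
    swap : ∀ a b c → a * b * c ≡ a * c * b
    swap = solve-∀
    swap′ : ∀ a b c → a * (b * c) ≡ a * c * b
    swap′ = solve-∀

module ConditionalExpectations where

  open import Data.Nat hiding (_≟_)
  open import Data.Nat.Properties hiding (_≟_)
  open import Data.Nat.ListAction using (sum)
  open import Data.Bool using (Bool; true; false; if_then_else_; _∧_)
  open import Data.Bool.Properties using (∧-identityʳ; ∧-zeroʳ)
  open import Data.Fin using (Fin; zero; suc; _≟_)
  open import Data.List using (List; []; _∷_; _++_; map; filterᵇ; length; tabulate; allFin; cartesianProduct)
  open import Data.List.Properties using (map-cong; map-++; map-∘; length-tabulate)
  open import Data.Nat.ListAction.Properties using (sum-++)
  open import Data.List.Membership.Propositional using (_∈_)
  open import Data.List.Membership.Propositional.Properties using (∈-map⁺; ∈-cartesianProduct⁺; ∈-allFin)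
  open import Data.List.Relation.Unary.Any using (here; there)
  open import Data.Product using (∃-syntax; Σ-syntax; _×_; _,_; proj₁; proj₂)
  import Data.Vec.Functional as Vector
  open import Function using (_∘_; id)
  open import Relation.Binary.PropositionalEquality
  open import Relation.Nullary using (yes; no; does)
  open import Algebra.Properties.Semiring.Sum +-*-semiring
    using (∑-distrib-+; *-distribˡ-sum; *-distribʳ-sum; sum-replicate-zero; sum-cong-≗)
    renaming (sum to ∑)
  open import Algebra.Properties.Monoid.Sum *-1-monoid using () renaming (sum to ∏; sum-cong-≗ to ∏-cong-≗)
  open import Data.Nat.Tactic.RingSolver using (solve-∀)

  ∃-*-≤-∑ : ∀ k (h : Fin (suc k) → ℕ) → ∃[ p ] suc k * h p ≤ ∑ h
  ∃-*-≤-∑ zero    h = zero , ≤-refl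
  ∃-*-≤-∑ (suc k) h with ∃-*-≤-∑ k (h ∘ suc)
  ... | p , kh≤∑ with h zero ≤? h (suc p)
  ...   | yes h₀≤ = zero , +-monoʳ-≤ (h zero) (≤-trans (*-monoʳ-≤ (suc k) h₀≤) kh≤∑)
  ...   | no h₀≰  = suc p , +-mono-≤ (<⇒≤ (≰⇒> h₀≰)) kh≤∑

  ∑-sum-map : ∀ {A : Set} {K} (h : Fin K → A → ℕ) xs →
              ∑ (λ p → sum (map (h p) xs)) ≡ sum (map (λ a → ∑ (λ p → h p a)) xs)
  ∑-sum-map {K = K} h []       = sum-replicate-zero K
  ∑-sum-map         h (x ∷ xs) = trans (∑-distrib-+ (λ p → h p x) (λ p → sum (map (h p) xs)))
                                       (cong (∑ (λ p → h p x) +_) (∑-sum-map h xs))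

  -- The right-hand side is the sum of the estimator over all K^n functions, so f does no worse than
  -- average. It is built one value at a time, each value not increasing the conditional average.
  ∃-≤-average : ∀ {A : Set} {k} n (xs : List A) (α : A → ℕ) (w : A → Fin n → Fin (suc k) → ℕ) →
    Σ[ f ∈ (Fin n → Fin (suc k)) ] suc k ^ n * sum (map (λ a → α a * ∏ (λ u → w a u (f u))) xs)
             ≤ sum (map (λ a → α a * ∏ (λ u → ∑ (w a u))) xs)
  ∃-≤-average zero xs α w = (λ ()) , ≤-reflexive (+-identityʳ _)
  ∃-≤-average {A} {k} (suc n) xs α w = p Vector.∷ f , (begin
    K * K ^ n * sum (map (λ a → α a * (w a zero p * ∏ (λ u → w′ a u (f u)))) xs)
      ≡⟨ *-assoc K (K ^ n) _ ⟩
    K * (K ^ n * sum (map (λ a → α a * (w a zero p * ∏ (λ u → w′ a u (f u)))) xs))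
      ≡⟨ cong (λ z → K * (K ^ n * sum z)) (map-cong (λ a → *-assoc (α a) (w a zero p) _) xs) ⟨
    K * (K ^ n * sum (map (λ a → α′ p a * ∏ (λ u → w′ a u (f u))) xs))
      ≤⟨ *-monoʳ-≤ K Kⁿval≤Bp ⟩
    K * B p
      ≤⟨ KBp≤∑B ⟩
    ∑ B
      ≡⟨ ∑-sum-map (λ p a → α′ p a * R a) xs ⟩
    sum (map (λ a → ∑ (λ p → α a * w a zero p * R a)) xs)
      ≡⟨ cong sum (map-cong factor xs) ⟩
    sum (map (λ a → α a * (∑ (w a zero) * R a)) xs) ∎)
    where
    open ≤-Reasoning
    K = suc k
    α′ : Fin K → A → ℕ
    α′ p a = α a * w a zero p
    w′ : A → Fin n → Fin K → ℕ
    w′ a u = w a (suc u)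
    R : A → ℕ
    R a = ∏ (λ u → ∑ (w′ a u))
    B : Fin K → ℕ
    B p = sum (map (λ a → α′ p a * R a) xs)
    p : Fin K
    p = proj₁ (∃-*-≤-∑ k B)
    KBp≤∑B : K * B p ≤ ∑ B
    KBp≤∑B = proj₂ (∃-*-≤-∑ k B)
    f : Fin n → Fin K
    f = proj₁ (∃-≤-average n xs (α′ p) w′)
    Kⁿval≤Bp : K ^ n * sum (map (λ a → α′ p a * ∏ (λ u → w′ a u (f u))) xs) ≤ B p
    Kⁿval≤Bp = proj₂ (∃-≤-average n xs (α′ p) w′)
    factor : ∀ a → ∑ (λ p → α a * w a zero p * R a) ≡ α a * (∑ (w a zero) * R a)
    factor a = begin-equality
      ∑ (λ p → α a * w a zero p * R a)  ≡⟨ *-distribʳ-sum (R a) (λ p → α a * w a zero p) ⟨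
      ∑ (λ p → α a * w a zero p) * R a  ≡⟨ cong (_* R a) (*-distribˡ-sum (α a) (w a zero)) ⟨
      α a * ∑ (w a zero) * R a          ≡⟨ *-assoc (α a) _ (R a) ⟩
      α a * (∑ (w a zero) * R a)        ∎

  ∈⇒≤sum : ∀ {n ns} → n ∈ ns → n ≤ sum ns
  ∈⇒≤sum {ns = m ∷ ns} (here refl) = m≤m+n m (sum ns)
  ∈⇒≤sum {ns = m ∷ ns} (there n∈ns) = ≤-trans (∈⇒≤sum n∈ns) (m≤n+m (sum ns) m)

  count : ∀ {n} → (Fin n → Bool) → ℕ
  count P = ∑ (λ u → if P u then 1 else 0)

  count-cong : ∀ {n} {P Q : Fin n → Bool} → (∀ u → P u ≡ Q u) → count P ≡ count Q
  count-cong P≗Q = sum-cong-≗ (λ u → cong (λ b → if b then 1 else 0) (P≗Q u))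

  length-filterᵇ-tabulate : ∀ {A : Set} {n} (P : A → Bool) (g : Fin n → A) →
                            length (filterᵇ P (tabulate g)) ≡ count (P ∘ g)
  length-filterᵇ-tabulate {n = zero}  P g = refl
  length-filterᵇ-tabulate {n = suc n} P g with P (g zero)
  ... | true  = cong suc (length-filterᵇ-tabulate P (g ∘ suc))
  ... | false = length-filterᵇ-tabulate P (g ∘ suc)

  2^count : ∀ {n} (P : Fin n → Bool) → 2 ^ count P ≡ ∏ (λ u → if P u then 2 else 1)
  2^count {zero}  P = refl
  2^count {suc n} P with P zero
  ... | true  = cong (2 *_) (2^count (P ∘ suc))
  ... | false = trans (2^count (P ∘ suc)) (sym (+-identityʳ _))

  ∏-*-^-count : ∀ K {n} (P : Fin n → Bool) →
                ∏ (λ u → if P u then suc K else K) * K ^ count P ≡ suc K ^ count P * K ^ n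
  ∏-*-^-count K {zero}  P = refl
  ∏-*-^-count K {suc n} P with P zero
  ... | true  = begin
    suc K * Π * (K * Kᶜ)       ≡⟨ shuffle (suc K) Π K Kᶜ ⟩
    suc K * K * (Π * Kᶜ)       ≡⟨ cong (suc K * K *_) (∏-*-^-count K (P ∘ suc)) ⟩
    suc K * K * (Sᶜ * K ^ n)   ≡⟨ shuffle (suc K) K Sᶜ (K ^ n) ⟩
    suc K * Sᶜ * (K * K ^ n)   ∎
    where
    open ≡-Reasoning
    Π = ∏ (λ u → if P (suc u) then suc K else K)
    Kᶜ = K ^ count (P ∘ suc)
    Sᶜ = suc K ^ count (P ∘ suc)
    shuffle : ∀ a b c d → a * b * (c * d) ≡ a * c * (b * d)
    shuffle = solve-∀
  ... | false = begin
    K * Π * Kᶜ       ≡⟨ *-assoc K Π Kᶜ ⟩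
    K * (Π * Kᶜ)     ≡⟨ cong (K *_) (∏-*-^-count K (P ∘ suc)) ⟩
    K * (Sᶜ * K ^ n) ≡⟨ swap K Sᶜ (K ^ n) ⟩
    Sᶜ * (K * K ^ n) ∎
    where
    open ≡-Reasoning
    Π = ∏ (λ u → if P (suc u) then suc K else K)
    Kᶜ = K ^ count (P ∘ suc)
    Sᶜ = suc K ^ count (P ∘ suc)
    swap : ∀ a b c → a * (b * c) ≡ b * (a * c)
    swap = solve-∀

  ∏-const : ∀ {n} c → ∏ {n} (λ _ → c) ≡ c ^ n
  ∏-const {zero}  c = refl
  ∏-const {suc n} c = cong (c *_) (∏-const {n} c)

  ∏-*-^-≤ : ∀ K {n} (P : Fin n → Bool) {d} → count P ≤ d → ∏ (λ u → if P u then suc K else K) * K ^ d ≤ suc K ^ d * K ^ n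
  ∏-*-^-≤ K {n} P {d} c≤d = begin
    Π * K ^ d                          ≡⟨ cong (λ e → Π * K ^ e) (m+[n∸m]≡n c≤d) ⟨
    Π * K ^ (c + e)                    ≡⟨ cong (Π *_) (^-distribˡ-+-* K c e) ⟩
    Π * (K ^ c * K ^ e)                ≡⟨ *-assoc Π (K ^ c) (K ^ e) ⟨
    Π * K ^ c * K ^ e                  ≡⟨ cong (_* K ^ e) (∏-*-^-count K P) ⟩
    suc K ^ c * K ^ n * K ^ e          ≤⟨ *-monoʳ-≤ (suc K ^ c * K ^ n) (^-monoˡ-≤ e (n≤1+n K)) ⟩
    suc K ^ c * K ^ n * suc K ^ e      ≡⟨ swap (suc K ^ c) (K ^ n) (suc K ^ e) ⟩
    suc K ^ c * suc K ^ e * K ^ n      ≡⟨ cong (_* K ^ n) (^-distribˡ-+-* (suc K) c e) ⟨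
    suc K ^ (c + e) * K ^ n            ≡⟨ cong (λ e → suc K ^ e * K ^ n) (m+[n∸m]≡n c≤d) ⟩
    suc K ^ d * K ^ n                  ∎
    where
    open ≤-Reasoning
    Π = ∏ (λ u → if P u then suc K else K)
    c = count P
    e = d ∸ c
    swap : ∀ a b c → a * b * c ≡ a * c * b
    swap = solve-∀

  private
    ∑-ones : ∀ K → ∑ {K} (λ _ → 1) ≡ K
    ∑-ones zero    = refl
    ∑-ones (suc K) = cong suc (∑-ones K)

  ∑-weight : ∀ {K} (i : Fin K) b → ∑ (λ p → if does (p ≟ i) ∧ b then 2 else 1) ≡ (if b then suc K else K)
  ∑-weight i true  = trans (sum-cong-≗ (λ p → cong (λ z → if z then 2 else 1) (∧-identityʳ (does (p ≟ i))))) (∑-marked i)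
    where
    ∑-marked : ∀ {K} (i : Fin K) → ∑ (λ p → if does (p ≟ i) then 2 else 1) ≡ suc K
    ∑-marked {suc K} zero    = cong (2 +_) (∑-ones K)
    ∑-marked {suc K} (suc i) = cong suc (∑-marked i)
  ∑-weight i false = trans (sum-cong-≗ (λ p → cong (λ z → if z then 2 else 1) (∧-zeroʳ (does (p ≟ i))))) (∑-ones _)

  sum-map-*-≤ : ∀ {A : Set} (h : A → ℕ) {m b} xs → (∀ {x} → x ∈ xs → h x * m ≤ b) → sum (map h xs) * m ≤ length xs * b
  sum-map-*-≤ h []       h≤b = z≤n
  sum-map-*-≤ h {m} {b} (x ∷ xs) h≤b = begin
    (h x + sum (map h xs)) * m      ≡⟨ *-distribʳ-+ m (h x) (sum (map h xs)) ⟩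
    h x * m + sum (map h xs) * m    ≤⟨ +-mono-≤ (h≤b (here refl)) (sum-map-*-≤ h xs (h≤b ∘ there)) ⟩
    b + length xs * b               ∎
    where open ≤-Reasoning

  private
    sum-map-const : ∀ {A : Set} c (ys : List A) → sum (map (λ _ → c) ys) ≡ length ys * c
    sum-map-const c []       = refl
    sum-map-const c (y ∷ ys) = cong (c +_) (sum-map-const c ys)

  sum-map-cartesianProduct-allFin : ∀ {A : Set} {K} (h : A → ℕ) xs →
    sum (map (h ∘ proj₁) (cartesianProduct xs (allFin K))) ≡ K * sum (map h xs)
  sum-map-cartesianProduct-allFin {K = K} h []       = sym (*-zeroʳ K)
  sum-map-cartesianProduct-allFin {K = K} h (x ∷ xs) = begin
    sum (map (h ∘ proj₁) (map (x ,_) (allFin K) ++ cartesianProduct xs (allFin K)))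
      ≡⟨ cong sum (map-++ (h ∘ proj₁) (map (x ,_) (allFin K)) _) ⟩
    sum (map (h ∘ proj₁) (map (x ,_) (allFin K)) ++ map (h ∘ proj₁) (cartesianProduct xs (allFin K)))
      ≡⟨ sum-++ (map (h ∘ proj₁) (map (x ,_) (allFin K))) _ ⟩
    sum (map (h ∘ proj₁) (map (x ,_) (allFin K))) + sum (map (h ∘ proj₁) (cartesianProduct xs (allFin K)))
      ≡⟨ cong₂ _+_ (cong sum (map-∘ (allFin K))) (sym (sum-map-cartesianProduct-allFin h xs)) ⟨
    sum (map (λ _ → h x) (allFin K)) + K * sum (map h xs)
      ≡⟨ cong (_+ K * sum (map h xs)) (trans (sum-map-const (h x) (allFin K)) (cong (_* h x) (length-tabulate {n = K} id))) ⟩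
    K * h x + K * sum (map h xs)
      ≡⟨ *-distribˡ-+ K (h x) (sum (map h xs)) ⟨
    K * sum (map h (x ∷ xs)) ∎
    where open ≡-Reasoning

  -- The hypothesis says that the expectations c e · ∏ (1 + [u ∈ D e] / K) of c e · 2^|D e ∩ f⁻¹(i)| for a
  -- uniformly random f, summed over e ∈ xs and all i, are below C.
  union-bound : ∀ {A : Set} {k} n (xs : List A) (c : A → ℕ) (D : A → Fin n → Bool) C →
    suc k * sum (map (λ e → c e * ∏ (λ u → if D e u then suc (suc k) else suc k)) xs) < suc k ^ n * C →
    Σ[ f ∈ (Fin n → Fin (suc k)) ] ∀ {e} → e ∈ xs → ∀ i → c e * 2 ^ count (λ u → does (f u ≟ i) ∧ D e u) < C
  union-bound {A} {k} n xs c D C expectation<C = f , λ {e} e∈xs i → begin-strict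
    c e * 2 ^ count (λ u → does (f u ≟ i) ∧ D e u) ≡⟨ cong (c e *_) (2^count (λ u → does (f u ≟ i) ∧ D e u)) ⟩
    c e * ∏ (λ u → w (e , i) u (f u))              ≤⟨ ∈⇒≤sum (∈-map⁺ (λ a → α a * ∏ (λ u → w a u (f u)))
                                                         (∈-cartesianProduct⁺ e∈xs (∈-allFin i))) ⟩
    value                                          <⟨ value<C ⟩
    C                                              ∎
    where
    open ≤-Reasoning
    K = suc k
    events = cartesianProduct xs (allFin K)
    α : A × Fin K → ℕ
    α = c ∘ proj₁
    w : A × Fin K → Fin n → Fin K → ℕ
    w (e , i) u p = if does (p ≟ i) ∧ D e u then 2 else 1
    f = proj₁ (∃-≤-average n events α w)
    value = sum (map (λ a → α a * ∏ (λ u → w a u (f u))) events)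
    E : A → ℕ
    E e = c e * ∏ (λ u → if D e u then suc K else K)
    value<C : value < C
    value<C = *-cancelˡ-< (K ^ n) value C (begin-strict
      K ^ n * value                                         ≤⟨ proj₂ (∃-≤-average n events α w) ⟩
      sum (map (λ a → α a * ∏ (λ u → ∑ (w a u))) events)    ≡⟨ cong sum (map-cong (λ (e , i) →
                                                                 cong (c e *_) (∏-cong-≗ (λ u → ∑-weight i (D e u)))) events) ⟩
      sum (map (E ∘ proj₁) events)                          ≡⟨ sum-map-cartesianProduct-allFin E xs ⟩
      K * sum (map E xs)                                    <⟨ expectation<C ⟩
      K ^ n * C                                             ∎)

module SubsetCounting where

  open import Data.Nat
  import Data.Nat as ℕ
  open import Data.Nat.Properties
  open import Data.Bool using (Bool; true; false; not; _∧_; T)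
  open import Data.Empty using (⊥-elim)
  open import Data.Fin.Subset using (Subset; ∣_∣; _∪_; ⁅_⁆; inside; outside; ⊥)
  open import Data.Fin.Subset.Properties using (_⊆?_; p⊆q⇒∣p∣≤∣q∣; ∪-identityʳ)
  open import Data.List using (List; []; _∷_; map; _++_; filterᵇ; length)
  open import Data.List.Properties using (length-++; filter-++)
  open import Data.List.Membership.Propositional using (_∈_)
  open import Data.List.Membership.Propositional.Properties using (∈-map⁺; ∈-++⁺ˡ; ∈-++⁺ʳ; ∈-filter⁺; ∈-filter⁻)
  open import Data.List.Relation.Unary.Any using (here; there)
  open import Data.Product using (proj₂)
  open import Data.Unit using (tt)
  open import Data.Vec using (_∷_; []; lookup)
  open import Function using (_∘_)
  open import Relation.Binary.PropositionalEquality
  open import Relation.Nullary using (does; yes)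
  open import Relation.Nullary.Decidable using (T?)
  open import Defs using (allSubsets)
  open ConditionalExpectations using (count)

  ∈-allSubsets : ∀ {n} (S : Subset n) → S ∈ allSubsets n
  ∈-allSubsets []            = here refl
  ∈-allSubsets {suc n} (true ∷ S)  = ∈-++⁺ˡ (∈-map⁺ (inside ∷_) (∈-allSubsets S))
  ∈-allSubsets {suc n} (false ∷ S) = ∈-++⁺ʳ (map (inside ∷_) (allSubsets n)) (∈-map⁺ (outside ∷_) (∈-allSubsets S))

  subsetsOfSize : ∀ n → ℕ → List (Subset n)
  subsetsOfSize n j = filterᵇ (λ S → does (∣ S ∣ ℕ.≟ j)) (allSubsets n)

  ∈-subsetsOfSize⁺ : ∀ {n j} {S : Subset n} → ∣ S ∣ ≡ j → S ∈ subsetsOfSize n j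
  ∈-subsetsOfSize⁺ {j = j} {S} ∣S∣≡j =
    ∈-filter⁺ (T? ∘ λ S → does (∣ S ∣ ℕ.≟ j)) (∈-allSubsets S) (≡⇒≡ᵇ ∣ S ∣ j ∣S∣≡j)

  ∈-subsetsOfSize⁻ : ∀ {n j} {S : Subset n} → S ∈ subsetsOfSize n j → ∣ S ∣ ≡ j
  ∈-subsetsOfSize⁻ {n} {j} {S} S∈ =
    ≡ᵇ⇒≡ ∣ S ∣ j (proj₂ (∈-filter⁻ (T? ∘ λ S → does (∣ S ∣ ℕ.≟ j)) {xs = allSubsets n} S∈))

  private
    length-filterᵇ-map : ∀ {A B : Set} (P : B → Bool) (f : A → B) xs →
                         length (filterᵇ P (map f xs)) ≡ length (filterᵇ (P ∘ f) xs)
    length-filterᵇ-map P f []       = refl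
    length-filterᵇ-map P f (x ∷ xs) with P (f x)
    ... | true  = cong suc (length-filterᵇ-map P f xs)
    ... | false = length-filterᵇ-map P f xs

  length-filterᵇ-allSubsets : ∀ {n} (P : Subset (suc n) → Bool) →
    length (filterᵇ P (allSubsets (suc n)))
      ≡ length (filterᵇ (P ∘ (inside ∷_)) (allSubsets n)) + length (filterᵇ (P ∘ (outside ∷_)) (allSubsets n))
  length-filterᵇ-allSubsets {n} P = begin
    length (filterᵇ P (map (inside ∷_) (allSubsets n) ++ map (outside ∷_) (allSubsets n)))
      ≡⟨ cong length (filter-++ (T? ∘ P) (map (inside ∷_) (allSubsets n)) _) ⟩
    length (filterᵇ P (map (inside ∷_) (allSubsets n)) ++ filterᵇ P (map (outside ∷_) (allSubsets n)))
      ≡⟨ length-++ (filterᵇ P (map (inside ∷_) (allSubsets n))) ⟩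
    length (filterᵇ P (map (inside ∷_) (allSubsets n))) + length (filterᵇ P (map (outside ∷_) (allSubsets n)))
      ≡⟨ cong₂ _+_ (length-filterᵇ-map P _ (allSubsets n)) (length-filterᵇ-map P _ (allSubsets n)) ⟩
    length (filterᵇ (P ∘ (inside ∷_)) (allSubsets n)) + length (filterᵇ (P ∘ (outside ∷_)) (allSubsets n)) ∎
    where open ≡-Reasoning

  length-filterᵇ-≤ : ∀ {A : Set} {P Q : A → Bool} → (∀ x → T (P x) → T (Q x)) → ∀ xs →
                     length (filterᵇ P xs) ≤ length (filterᵇ Q xs)
  length-filterᵇ-≤ {P = P} {Q} P⇒Q [] = z≤n
  length-filterᵇ-≤ {P = P} {Q} P⇒Q (x ∷ xs) with P x in Px | Q x in Qx
  ... | true  | true  = s≤s (length-filterᵇ-≤ P⇒Q xs)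
  ... | false | true  = m≤n⇒m≤1+n (length-filterᵇ-≤ P⇒Q xs)
  ... | false | false = length-filterᵇ-≤ P⇒Q xs
  ... | true  | false = ⊥-elim (subst T Qx (P⇒Q x (subst T (sym Px) tt)))

  length-filterᵇ-none : ∀ {A : Set} {P : A → Bool} → (∀ x → P x ≡ false) → ∀ xs → length (filterᵇ P xs) ≡ 0
  length-filterᵇ-none none []       = refl
  length-filterᵇ-none {P = P} none (x ∷ xs) rewrite none x = length-filterᵇ-none none xs

  subsets-of-size-≤-^ : ∀ n j → length (subsetsOfSize n j) ≤ n ^ j
  subsets-of-size-≤-^ zero    zero    = ≤-refl
  subsets-of-size-≤-^ zero    (suc j) = z≤n
  subsets-of-size-≤-^ (suc n) zero
    rewrite length-filterᵇ-allSubsets {n} (λ S → does (∣ S ∣ ℕ.≟ zero))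
          | length-filterᵇ-none {P = λ S → does (suc ∣ S ∣ ℕ.≟ zero)} (λ _ → refl) (allSubsets n)
    = subsets-of-size-≤-^ n zero
  subsets-of-size-≤-^ (suc n) (suc j) rewrite length-filterᵇ-allSubsets {n} (λ S → does (∣ S ∣ ℕ.≟ suc j)) = begin
    length (subsetsOfSize n j) + length (subsetsOfSize n (suc j))
      ≤⟨ +-mono-≤ (subsets-of-size-≤-^ n j) (subsets-of-size-≤-^ n (suc j)) ⟩
    n ^ j + n * n ^ j
      ≤⟨ +-mono-≤ (^-monoˡ-≤ j (n≤1+n n)) (*-monoʳ-≤ n (^-monoˡ-≤ j (n≤1+n n))) ⟩
    suc n ^ j + n * suc n ^ j ∎
    where open ≤-Reasoning

  private
    ⊆?-refl : ∀ {n} (S : Subset n) → does (S ⊆? S) ≡ true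
    ⊆?-refl []          = refl
    ⊆?-refl (true ∷ S)  = ⊆?-refl S
    ⊆?-refl (false ∷ S) = ⊆?-refl S

    ∣∣≤∣∣-of-⊆? : ∀ {n} (S e : Subset n) → does (S ⊆? e) ≡ true → ∣ S ∣ ≤ ∣ e ∣
    ∣∣≤∣∣-of-⊆? S e S⊆?e with S ⊆? e
    ... | yes S⊆e = p⊆q⇒∣p∣≤∣q∣ S⊆e

    not-⊆?-smaller : ∀ {n} (S e : Subset n) → (does (S ⊆? e) ∧ (suc ∣ e ∣ ≡ᵇ ∣ S ∣)) ≡ false
    not-⊆?-smaller S e with does (S ⊆? e) in S⊆?e | suc ∣ e ∣ ≡ᵇ ∣ S ∣ in size
    ... | false | _     = refl
    ... | true  | false = refl
    ... | true  | true  = ⊥-elim (<⇒≱ (≤-reflexive (≡ᵇ⇒≡ (suc ∣ e ∣) ∣ S ∣ (subst T (sym size) tt)))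
                                       (∣∣≤∣∣-of-⊆? S e S⊆?e))

  supersets-of-equal-size-≤-1 : ∀ n (S : Subset n) →
    length (filterᵇ (λ e → does (S ⊆? e) ∧ (∣ e ∣ ≡ᵇ ∣ S ∣)) (allSubsets n)) ≤ 1
  supersets-of-equal-size-≤-1 zero [] = ≤-refl
  supersets-of-equal-size-≤-1 (suc n) (true ∷ S)
    rewrite length-filterᵇ-allSubsets {n} (λ e → does ((true ∷ S) ⊆? e) ∧ (∣ e ∣ ≡ᵇ ∣ true ∷ S ∣))
          | length-filterᵇ-none {P = λ e → does ((true ∷ S) ⊆? (false ∷ e)) ∧ (∣ false ∷ e ∣ ≡ᵇ ∣ true ∷ S ∣)}
              (λ _ → refl) (allSubsets n)
          | +-identityʳ (length (filterᵇ (λ e → does (S ⊆? e) ∧ (∣ e ∣ ≡ᵇ ∣ S ∣)) (allSubsets n)))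
    = supersets-of-equal-size-≤-1 n S
  supersets-of-equal-size-≤-1 (suc n) (false ∷ S)
    rewrite length-filterᵇ-allSubsets {n} (λ e → does ((false ∷ S) ⊆? e) ∧ (∣ e ∣ ≡ᵇ ∣ false ∷ S ∣))
          | length-filterᵇ-none {P = λ e → does (S ⊆? e) ∧ (suc ∣ e ∣ ≡ᵇ ∣ S ∣)} (not-⊆?-smaller S) (allSubsets n)
    = supersets-of-equal-size-≤-1 n S

  supersets-of-size-suc-≤-n : ∀ n (S : Subset n) →
    length (filterᵇ (λ e → does (S ⊆? e) ∧ (∣ e ∣ ≡ᵇ suc ∣ S ∣)) (allSubsets n)) ≤ n
  supersets-of-size-suc-≤-n zero [] = z≤n
  supersets-of-size-suc-≤-n (suc n) (true ∷ S)
    rewrite length-filterᵇ-allSubsets {n} (λ e → does ((true ∷ S) ⊆? e) ∧ (∣ e ∣ ≡ᵇ suc ∣ true ∷ S ∣))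
          | length-filterᵇ-none {P = λ e → does ((true ∷ S) ⊆? (false ∷ e)) ∧ (∣ false ∷ e ∣ ≡ᵇ suc ∣ true ∷ S ∣)}
              (λ _ → refl) (allSubsets n)
          | +-identityʳ (length (filterᵇ (λ e → does (S ⊆? e) ∧ (∣ e ∣ ≡ᵇ suc ∣ S ∣)) (allSubsets n)))
    = m≤n⇒m≤1+n (supersets-of-size-suc-≤-n n S)
  supersets-of-size-suc-≤-n (suc n) (false ∷ S)
    rewrite length-filterᵇ-allSubsets {n} (λ e → does ((false ∷ S) ⊆? e) ∧ (∣ e ∣ ≡ᵇ suc ∣ false ∷ S ∣))
    = +-mono-≤ (supersets-of-equal-size-≤-1 n S) (supersets-of-size-suc-≤-n n S)

  private
    ∈⇒1≤length : ∀ {A : Set} {x : A} {xs} → x ∈ xs → 1 ≤ length xs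
    ∈⇒1≤length (here _)  = s≤s z≤n
    ∈⇒1≤length (there _) = s≤s z≤n

  -- u ↦ S ∪ {u} is injective on the complement of S.
  count-∉-∪-≤ : ∀ n (S : Subset n) (Q : Subset n → Bool) →
    count (λ u → not (lookup S u) ∧ Q (S ∪ ⁅ u ⁆)) ≤ length (filterᵇ (λ e → does (S ⊆? e) ∧ Q e) (allSubsets n))
  count-∉-∪-≤ zero [] Q = z≤n
  count-∉-∪-≤ (suc n) (true ∷ S) Q rewrite length-filterᵇ-allSubsets {n} (λ e → does ((true ∷ S) ⊆? e) ∧ Q e) =
    ≤-trans (count-∉-∪-≤ n S (Q ∘ (inside ∷_))) (m≤m+n _ _)
  count-∉-∪-≤ (suc n) (false ∷ S) Q rewrite length-filterᵇ-allSubsets {n} (λ e → does ((false ∷ S) ⊆? e) ∧ Q e)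
    with Q (inside ∷ (S ∪ ⊥)) in Q[S+0]
  ... | false = ≤-trans (count-∉-∪-≤ n S (Q ∘ (outside ∷_))) (m≤n+m _ _)
  ... | true  = +-mono-≤
    (∈⇒1≤length (∈-filter⁺ (T? ∘ (λ e → does (S ⊆? e) ∧ Q (inside ∷ e))) (∈-allSubsets S) S∪0∈))
    (count-∉-∪-≤ n S (Q ∘ (outside ∷_)))
    where
    S∪0∈ : T (does (S ⊆? S) ∧ Q (inside ∷ S))
    S∪0∈ = subst T (sym (trans (cong (_∧ Q (inside ∷ S)) (⊆?-refl S))
                              (trans (cong (λ z → Q (inside ∷ z)) (sym (∪-identityʳ S))) Q[S+0]))) tt

module HypergraphDegrees where

  open import Data.Nat
  open import Data.Nat.Properties
  open import Data.Bool using (true; false; not; _∧_; T)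
  open import Data.Bool.Properties using (∧-comm; ∨-identityʳ)
  open import Data.Empty using (⊥-elim)
  open import Data.Fin using (zero; suc)
  open import Data.Fin.Subset using (Subset; ∣_∣; _∪_; ⁅_⁆)
  open import Data.Fin.Subset.Properties using (_⊆?_; ∪-identityʳ)
  open import Data.List using (map; filterᵇ; length)
  open import Data.List.Properties using (foldr-preservesᵇ; foldr-preservesᵒ)
  open import Data.List.Membership.Propositional.Properties using (∈-map⁺)
  import Data.List.Relation.Unary.All as All
  import Data.List.Relation.Unary.All.Properties as All
  import Data.List.Relation.Unary.Any as Any
  open import Data.Sum using ([_,_]; inj₂)
  open import Data.Unit using (tt)
  open import Data.Vec using (_∷_; lookup)
  open import Relation.Binary.PropositionalEquality
  open import Relation.Nullary using (does)
  open import Defs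
  open ConditionalExpectations using (count; count-cong)
  open SubsetCounting

  private
    ∪-⁅⁆-of-lookup : ∀ {n} (S : Subset n) u → lookup S u ≡ true → S ∪ ⁅ u ⁆ ≡ S
    ∪-⁅⁆-of-lookup (true ∷ S) zero    _  = cong (true ∷_) (∪-identityʳ S)
    ∪-⁅⁆-of-lookup (s ∷ S)    (suc u) eq = cong₂ _∷_ (∨-identityʳ s) (∪-⁅⁆-of-lookup S u eq)

  module _ {r : ℕ} (X : UniformHypergraph (suc r)) where

    degree-≤-Δ : ∀ S → ∣ S ∣ ≡ r → degree X S ≤ Δ X
    degree-≤-Δ S ∣S∣≡r = foldr-preservesᵒ {P = degree X S ≤_} {f = _⊔_}
      (λ x y → [ m≤n⇒m≤n⊔o y , m≤n⇒m≤o⊔n x ]) 0 (map (degree X) (subsetsOfSize (v X) r))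
      (inj₂ (Any.map ≤-reflexive (∈-map⁺ (degree X) (∈-subsetsOfSize⁺ {S = S} ∣S∣≡r))))

    degree-≤-v : ∀ S → ∣ S ∣ ≡ r → degree X S ≤ v X
    degree-≤-v S ∣S∣≡r = ≤-trans (length-filterᵇ-≤ edge⇒superset (allSubsets (v X))) (supersets-of-size-suc-≤-n (v X) S)
      where
      edge⇒superset : ∀ e → T (isEdge X e ∧ does (S ⊆? e)) → T (does (S ⊆? e) ∧ (∣ e ∣ ≡ᵇ suc ∣ S ∣))
      edge⇒superset e h with isEdge X e in edge | does (S ⊆? e)
      ... | true | true = ≡⇒≡ᵇ ∣ e ∣ (suc ∣ S ∣) (trans (uniform X e (subst T (sym edge) tt)) (cong suc (sym ∣S∣≡r)))

    Δ-≤-v : Δ X ≤ v X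
    Δ-≤-v = foldr-preservesᵇ {P = _≤ v X} {f = _⊔_} ⊔-lub z≤n (All.map⁺ {f = degree X} (All.tabulate λ {S} S∈ →
      degree-≤-v S (∈-subsetsOfSize⁻ S∈)))

    count-edges-≤-Δ : ∀ S → ∣ S ∣ ≡ r → count (λ u → isEdge X (S ∪ ⁅ u ⁆)) ≤ Δ X
    count-edges-≤-Δ S ∣S∣≡r = begin
      count (λ u → isEdge X (S ∪ ⁅ u ⁆))                           ≡⟨ count-cong outside-S ⟩
      count (λ u → not (lookup S u) ∧ isEdge X (S ∪ ⁅ u ⁆))        ≤⟨ count-∉-∪-≤ (v X) S (isEdge X) ⟩
      length (filterᵇ (λ e → does (S ⊆? e) ∧ isEdge X e) (allSubsets (v X)))
        ≤⟨ length-filterᵇ-≤ (λ e → subst T (∧-comm (does (S ⊆? e)) (isEdge X e))) (allSubsets (v X)) ⟩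
      degree X S                                                  ≤⟨ degree-≤-Δ S ∣S∣≡r ⟩
      Δ X                                                         ∎
      where
      open ≤-Reasoning
      outside-S : ∀ u → isEdge X (S ∪ ⁅ u ⁆) ≡ not (lookup S u) ∧ isEdge X (S ∪ ⁅ u ⁆)
      outside-S u with lookup S u in u∈S
      ... | false = refl
      ... | true with isEdge X (S ∪ ⁅ u ⁆) in edge
      ...   | false = refl
      ...   | true  = ⊥-elim (1+n≢n (sym (trans (sym ∣S∣≡r)
                        (uniform X S (subst T (trans (sym edge) (cong (isEdge X) (∪-⁅⁆-of-lookup S u u∈S))) tt)))))

module Thresholds where

  open import Data.Nat
  open import Data.Nat.Properties
  open import Data.Nat.DivMod using (_/_; _%_; m≡m%n+[m/n]*n; m%n<n; m/n*n≤m)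
  open import Relation.Binary.PropositionalEquality
  open import Data.Nat.Tactic.RingSolver using (solve-∀)

  <-*-suc-/ : ∀ m K .{{_ : NonZero K}} → m < K * suc (m / K)
  <-*-suc-/ m K = begin-strict
    m                    ≡⟨ m≡m%n+[m/n]*n m K ⟩
    m % K + m / K * K    <⟨ +-monoˡ-< (m / K * K) (m%n<n m K) ⟩
    K + m / K * K        ≡⟨ cong (K +_) (*-comm (m / K) K) ⟩
    K + K * (m / K)      ≡⟨ *-suc K (m / K) ⟨
    K * suc (m / K)      ∎
    where open ≤-Reasoning

  *-≤-of-2^-< : ∀ K .{{_ : NonZero K}} M x c → c * 2 ^ x < c * 2 ^ suc (M / K) → K * x ≤ M
  *-≤-of-2^-< K M x c lt = begin
    K * x         ≤⟨ *-monoʳ-≤ K (s≤s⁻¹ (≰⇒> λ x≥ → <⇒≱ (*-cancelˡ-< c _ _ lt) (^-monoʳ-≤ 2 x≥))) ⟩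
    K * (M / K)   ≡⟨ *-comm K (M / K) ⟩
    M / K * K     ≤⟨ m/n*n≤m M K ⟩
    M             ∎
    where open ≤-Reasoning

  private
    halves-< : ∀ x y z → 2 * x < z → 2 * y < z → x + y < z
    halves-< x y z 2x<z 2y<z = *-cancelˡ-< 2 (x + y) z (begin-strict
      2 * (x + y)     ≡⟨ *-distribˡ-+ 2 x y ⟩
      2 * x + 2 * y   <⟨ +-mono-< 2x<z 2y<z ⟩
      z + z           ≡⟨ cong (z +_) (+-identityʳ z) ⟨
      2 * z           ∎)
      where open ≤-Reasoning

  -- Each of the two families of events takes less than half of the budget.
  union-budget : ∀ K n Δ P a₁ a₂ Σ₂ .{{_ : NonZero K}} → 1 ≤ P →
    2 * K * P * suc K ^ n < a₁ * K ^ n →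
    2 * K * P * suc K ^ Δ < a₂ * K ^ Δ →
    Σ₂ * K ^ Δ ≤ P * (a₁ * (suc K ^ Δ * K ^ n)) →
    K * (a₂ * suc K ^ n + Σ₂) < K ^ n * (a₁ * a₂)
  union-budget K n Δ P a₁ a₂ Σ₂ 1≤P sizes degrees Σ₂-bound = *-cancelʳ-< (K ^ Δ) _ _ (begin-strict
    K * (a₂ * B + Σ₂) * K ^ Δ                 ≡⟨ expand K a₂ B Σ₂ (K ^ Δ) ⟩
    K * a₂ * B * K ^ Δ + K * (Σ₂ * K ^ Δ)     <⟨ halves-< (K * a₂ * B * K ^ Δ) (K * (Σ₂ * K ^ Δ)) _ first second ⟩
    K ^ n * (a₁ * a₂) * K ^ Δ                 ∎)
    where
    open ≤-Reasoning
    B = suc K ^ n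
    first : 2 * (K * a₂ * B * K ^ Δ) < K ^ n * (a₁ * a₂) * K ^ Δ
    first = begin-strict
      2 * (K * a₂ * B * K ^ Δ)        ≡⟨ regroup K a₂ B (K ^ Δ) ⟩
      2 * K * 1 * B * (a₂ * K ^ Δ)    ≤⟨ *-monoˡ-≤ (a₂ * K ^ Δ) (*-monoˡ-≤ B (*-monoʳ-≤ (2 * K) 1≤P)) ⟩
      2 * K * P * B * (a₂ * K ^ Δ)    <⟨ *-monoˡ-< (a₂ * K ^ Δ) {{>-nonZero (≤-<-trans z≤n degrees)}} sizes ⟩
      a₁ * K ^ n * (a₂ * K ^ Δ)       ≡⟨ regroup′ a₁ (K ^ n) a₂ (K ^ Δ) ⟩
      K ^ n * (a₁ * a₂) * K ^ Δ       ∎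
      where
      regroup : ∀ K a B D → 2 * (K * a * B * D) ≡ 2 * K * 1 * B * (a * D)
      regroup = solve-∀
      regroup′ : ∀ a N b D → a * N * (b * D) ≡ N * (a * b) * D
      regroup′ = solve-∀
    second : 2 * (K * (Σ₂ * K ^ Δ)) < K ^ n * (a₁ * a₂) * K ^ Δ
    second = begin-strict
      2 * (K * (Σ₂ * K ^ Δ))                          ≤⟨ *-monoʳ-≤ 2 (*-monoʳ-≤ K Σ₂-bound) ⟩
      2 * (K * (P * (a₁ * (suc K ^ Δ * K ^ n))))      ≡⟨ regroup K P a₁ (suc K ^ Δ) (K ^ n) ⟩
      2 * K * P * suc K ^ Δ * (a₁ * K ^ n)            <⟨ *-monoˡ-< (a₁ * K ^ n) {{>-nonZero (≤-<-trans z≤n sizes)}} degrees ⟩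
      a₂ * K ^ Δ * (a₁ * K ^ n)                       ≡⟨ regroup′ a₂ (K ^ Δ) a₁ (K ^ n) ⟩
      K ^ n * (a₁ * a₂) * K ^ Δ                       ∎
      where
      regroup : ∀ K P a S N → 2 * (K * (P * (a * (S * N)))) ≡ 2 * K * P * S * (a * N)
      regroup = solve-∀
      regroup′ : ∀ b D a N → b * D * (a * N) ≡ N * (a * b) * D
      regroup′ = solve-∀
    expand : ∀ K a B S D → K * (a * B + S) * D ≡ K * a * B * D + K * (S * D)
    expand = solve-∀

module BalancedPartition where

  open import Data.Nat hiding (_≟_; _/_)
  open import Data.Nat.Properties hiding (_≟_)
  open import Data.Nat.DivMod using () renaming (_/_ to _div_)
  open import Data.Nat.ListAction using (sum)
  open import Data.Nat.Tactic.RingSolver using (solve-∀)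
  open import Data.Integer using (+_)
  open import Data.Rational using (_/_)
  open import Data.Bool using (Bool; true; if_then_else_; _∧_)
  open import Data.Bool.Properties using (∧-identityʳ)
  open import Data.Fin using (Fin; zero; _≟_)
  open import Data.Fin.Subset using (Subset; ∣_∣; _∪_; ⁅_⁆)
  open import Data.List using (List; _∷_; map; length; filterᵇ; allFin)
  open import Data.List.Properties using (map-∘)
  open import Data.List.Membership.Propositional using (_∈_)
  open import Data.List.Membership.Propositional.Properties using (∈-map⁺)
  open import Data.List.Relation.Unary.Any using (here; there)
  open import Data.Maybe using (Maybe; just; nothing)
  open import Data.Product using (Σ; _×_; _,_; proj₁; proj₂)
  open import Function using (_∘_; id)
  open import Relation.Binary.PropositionalEquality
  open import Relation.Nullary using (does)
  open import Algebra.Properties.Monoid.Sum *-1-monoid using () renaming (sum to ∏)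
  open import Defs
  open Fractions using (+/-≡)
  open ExponentialSeries using (expAtLeast⇒*-^-≤)
  open EulerRatios using (*-^-<-2^-*)
  open ConditionalExpectations
  open SubsetCounting using (subsetsOfSize; ∈-subsetsOfSize⁺; ∈-subsetsOfSize⁻; subsets-of-size-≤-^)
  open HypergraphDegrees
  open Thresholds

  IsBalanced : ∀ {r} (X : UniformHypergraph r) k → (Fin (v X) → Fin (suc k)) → Set
  IsBalanced {r} X k f =
    ((i : Fin (suc k)) → suc k * partSize f i ≤ 2 * v X) ×
    ((S : Subset (v X)) → ∣ S ∣ ≡ r ∸ 1 → (i : Fin (suc k)) → suc k * partDegree X f S i ≤ 2 * Δ X)

  module _ {r} (X : UniformHypergraph (suc r)) (k : ℕ) .{{_ : NonZero (v X)}} (g : ℕ) (g+1≡30K : suc g ≡ 30 * suc k)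
           (bound : 2 * suc k * v X ^ r * g ^ (10 * Δ X) ≤ suc g ^ (10 * Δ X)) where

    private
      K = suc k
      N = v X
      a₁ = 2 ^ suc (2 * N div K)
      a₂ = 2 ^ suc (2 * Δ X div K)

      -- nothing: the events |V_i| > 2 N / K; just S: the events d_{V_i}(S) > 2 Δ / K.
      events : List (Maybe (Subset N))
      events = nothing ∷ map just (subsetsOfSize N r)

      weight : Maybe (Subset N) → ℕ
      weight nothing  = a₂
      weight (just _) = a₁

      support : Maybe (Subset N) → Fin N → Bool
      support nothing  u = true
      support (just S) u = isEdge X (S ∪ ⁅ u ⁆)

      expectation : Maybe (Subset N) → ℕ
      expectation e = weight e * ∏ (λ u → if support e u then suc K else K)

      expectation-< : K * sum (map expectation events) < K ^ N * (a₁ * a₂)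
      expectation-< = subst (λ z → K * (a₂ * z + Σ₂) < K ^ N * (a₁ * a₂)) (sym (∏-const {N} (suc K)))
        (union-budget K N (Δ X) (N ^ r) a₁ a₂ Σ₂ (m^n>0 N r)
          (*-^-<-2^-* g k g+1≡30K (Δ X) N (2 * K * N ^ r) (2 * N div K) bound (Δ-≤-v X) (<-*-suc-/ (2 * N) K))
          (*-^-<-2^-* g k g+1≡30K (Δ X) (Δ X) (2 * K * N ^ r) (2 * Δ X div K) bound ≤-refl (<-*-suc-/ (2 * Δ X) K))
          Σ₂-bound)
        where
        Σ₂ = sum (map expectation (map just (subsetsOfSize N r)))
        Σ₂-bound : Σ₂ * K ^ Δ X ≤ N ^ r * (a₁ * (suc K ^ Δ X * K ^ N))
        Σ₂-bound = begin
          Σ₂ * K ^ Δ X                                         ≡⟨ cong (λ z → sum z * K ^ Δ X) (map-∘ (subsetsOfSize N r)) ⟨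
          sum (map (expectation ∘ just) (subsetsOfSize N r)) * K ^ Δ X
            ≤⟨ sum-map-*-≤ (expectation ∘ just) (subsetsOfSize N r) (λ {S} S∈ →
                 ≤-trans (≤-reflexive (*-assoc a₁ _ (K ^ Δ X)))
                         (*-monoʳ-≤ a₁ (∏-*-^-≤ K (support (just S)) (count-edges-≤-Δ X S (∈-subsetsOfSize⁻ S∈))))) ⟩
          length (subsetsOfSize N r) * (a₁ * (suc K ^ Δ X * K ^ N)) ≤⟨ *-monoˡ-≤ _ (subsets-of-size-≤-^ N r) ⟩
          N ^ r * (a₁ * (suc K ^ Δ X * K ^ N))                 ∎
          where open ≤-Reasoning

    partition : Σ (Fin N → Fin K) (IsBalanced X k)
    partition = f , part-sizes , part-degrees
      where
      f : Fin N → Fin K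
      f = proj₁ (union-bound N events weight support (a₁ * a₂) expectation-<)
      rare : ∀ {e} → e ∈ events → ∀ i → weight e * 2 ^ count (λ u → does (f u ≟ i) ∧ support e u) < a₁ * a₂
      rare = proj₂ (union-bound N events weight support (a₁ * a₂) expectation-<)
      part-sizes : ∀ i → K * partSize f i ≤ 2 * N
      part-sizes i = *-≤-of-2^-< K (2 * N) (partSize f i) a₂ (subst₂ (λ x y → a₂ * 2 ^ x < y)
        (trans (count-cong (λ u → ∧-identityʳ (does (f u ≟ i)))) (sym (length-filterᵇ-tabulate (λ u → does (f u ≟ i)) id)))
        (*-comm a₁ a₂) (rare (here refl) i))
      part-degrees : ∀ S → ∣ S ∣ ≡ r → ∀ i → K * partDegree X f S i ≤ 2 * Δ X
      part-degrees S ∣S∣≡r i = *-≤-of-2^-< K (2 * Δ X) (partDegree X f S i) a₁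
        (subst (λ x → a₁ * 2 ^ x < a₁ * a₂) (sym (length-filterᵇ-tabulate (λ u → does (f u ≟ i) ∧ support (just S) u) id))
          (rare (there (∈-map⁺ just (∈-subsetsOfSize⁺ {S = S} ∣S∣≡r))) i))

  empty-partition : ∀ {r} (X : UniformHypergraph r) k → v X ≡ 0 → Σ (Fin (v X) → Fin (suc k)) (IsBalanced X k)
  empty-partition X k v≡0 = (λ _ → zero) , (λ i → no-vertices _) , (λ S _ i → no-vertices _)
    where
    count-of-empty : ∀ {n} (P : Fin n → Bool) → n ≡ 0 → count P ≡ 0
    count-of-empty P refl = refl
    no-vertices : ∀ {b} (P : Fin (v X) → Bool) → suc k * length (filterᵇ P (allFin (v X))) ≤ b
    no-vertices {b} P = subst (_≤ b) (sym (trans (cong (suc k *_) (trans (length-filterᵇ-tabulate P id)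
                                                      (count-of-empty P v≡0))) (*-zeroʳ (suc k)))) z≤n

  1+[29+k*30]≡30*[1+k] : ∀ k → suc (29 + k * 30) ≡ 30 * suc k
  1+[29+k*30]≡30*[1+k] = solve-∀

  expAtLeast-/3K⇒*-^-≤ : ∀ g k → suc g ≡ 30 * suc k → ∀ Δ c → ExpAtLeast ((+ Δ) / (3 * suc k)) ((+ c) / 1) →
                         c * g ^ (10 * Δ) ≤ suc g ^ (10 * Δ)
  expAtLeast-/3K⇒*-^-≤ g k g+1≡30K Δ c = expAtLeast⇒*-^-≤ g (10 * Δ) c ∘
    subst (λ a → ExpAtLeast a ((+ c) / 1)) (+/-≡ Δ (3 * suc k) (10 * Δ) (suc g) cross)
    where
    cross : Δ * suc g ≡ 10 * Δ * (3 * suc k)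
    cross = trans (cong (Δ *_) g+1≡30K) (regroup Δ k)
      where
      regroup : ∀ Δ k → Δ * (30 * suc k) ≡ 10 * Δ * (3 * suc k)
      regroup = solve-∀

open import Defs
open import Data.Nat using (ℕ; suc; _*_; _^_; _≤_; _∸_)
open import Data.Fin using (Fin)
open import Data.Fin.Subset using (Subset; ∣_∣)
open import Data.Integer using (+_)
open import Data.Rational using (_/_)
open import Data.Product using (Σ; _×_)
open import Relation.Binary.PropositionalEquality using (_≡_)
import Data.Nat as ℕ
open import Relation.Nullary using (yes; no)
open BalancedPartition

proposition3p17 : (r : ℕ) → 1 ≤ r → (X : UniformHypergraph r) → (k : ℕ) →
    ExpAtLeast ((+ Δ X) / (3 * suc k)) (+ (2 * suc k * v X ^ (r ∸ 1)) / 1) →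
    Σ (Fin (v X) → Fin (suc k)) λ f →
      ((i : Fin (suc k)) → suc k * partSize f i ≤ 2 * v X) ×
      ((S : Subset (v X)) → ∣ S ∣ ≡ r ∸ 1 → (i : Fin (suc k)) →
         suc k * partDegree X f S i ≤ 2 * Δ X)
proposition3p17 (suc r) _ X k H with v X ℕ.≟ 0
... | yes v≡0 = empty-partition X k v≡0
... | no  v≢0 = partition X k {{ℕ.≢-nonZero v≢0}} g (1+[29+k*30]≡30*[1+k] k)
                  (expAtLeast-/3K⇒*-^-≤ g k (1+[29+k*30]≡30*[1+k] k) (Δ X) (2 * suc k * v X ^ r) H)
  where g = 29 ℕ.+ k * 30
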